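{- Let $G$ be a finite graph with vertex set $V$ and let $\omega:V\to\mathbb{Z}_{>0}$ be a weight function. For each subset $W\subseteq V$, let $a_W(1),a_W(2),\dots$ be the unique real numbers (possibly negative) such that, as formal power series in $t$, $$(1+t)^{a_W(1)}(1+t^2)^{a_W(2)}(1+t^3)^{a_W(3)}\cdots = I_{(G|_W,\omega)}(t).$$ Then $$\overline{X}_{(G,\omega)} = \sum_{W\subseteq V} (-1)^{|V\setminus W|}\prod_{k\ge 1}(1+\overline{p}_k)^{a_W(k)}.$$
   Context: For $W\subseteq V$, $G|_W$ is the induced subgraph on $W$ (vertex set $W$, edges of $G$ with both endpoints in $W$), with weights $\omega$ restricted to $W$. An independent (stable) set is a set of vertices no two of which are adjacent. For $S\subseteq V$, $\omega(S)=\sum_{v\in S}\omega(v)$. The independence polynomial is $I_{(H,\omega)}(t)=\sum_{S} t^{\omega(S)}$, the sum over all independent sets $S$ of $H$ (including $\varnothing$). For real $a$, $(1+u)^a$ means the formal series $\sum_{i\ge0}\binom{a}{i}u^i$ with $\binom{a}{i}=a(a-1)\cdots(a-i+1)/i!$. A proper set coloring of $(G,\omega)$ is a map $\alpha$ assigning to each vertex a nonempty subset of $\mathbb{Z}_{>0}$ such that $\alpha(u)\cap\alpha(v)=\varnothing$ whenever $uv$ is an edge. The Kromatic symmetric function is $\overline{X}_{(G,\omega)}=\sum_\alpha\prod_{v\in V}\prod_{i\in\alpha(v)}x_i^{\omega(v)}$, summed over proper set colorings. For a partition $\lambda$, $\overline{p}_\lambda:=\overline{X}_{\overline{K_\lambda}}$,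 where $\overline{K_\lambda}$ is the edgeless graph whose vertex weights are the parts of $\lambda$; $\overline{p}_k$ denotes $\overline{p}_\lambda$ for the one-part partition $\lambda=(k)$. -}

module Defs where

open import Data.Bool using (Bool; true; false; _∧_; _∨_; not; if_then_else_)
open import Data.Nat as ℕ using (ℕ; zero; suc; _≤_; _<_)
import Data.Nat.Properties as ℕP
open import Data.Integer as ℤ using (ℤ; +_)
open import Data.Rational as ℚ using (ℚ; 0ℚ; 1ℚ; _+_; _*_; _-_; -_)
open import Data.Fin using (Fin; zero; suc)
open import Data.Fin.Subset using (Subset; ∣_∣; ∁)
open import Data.Vec as Vec using (Vec; []; _∷_; lookup)
open import Data.List as List using (List; []; _∷_; _++_; concatMap; upTo)
open import Relation.Binary.PropositionalEquality using (_≡_)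
import Data.Nat.ListAction as NL

record Graph (n : ℕ) : Set where
  field
    adj   : Fin n → Fin n → Bool
    sym   : ∀ u v → adj u v ≡ adj v u
    irrefl : ∀ v → adj v v ≡ false
open Graph public

record PosWeight (n : ℕ) : Set where
  field
    wt  : Fin n → ℕ
    pos : ∀ v → 0 < wt v
open PosWeight public

allSubsets : (n : ℕ) → List (Subset n)
allSubsets zero = [] ∷ []
allSubsets (suc n) =
  List.map (true ∷_) (allSubsets n) ++ List.map (false ∷_) (allSubsets n)

allVecs : {A : Set} → List A → (n : ℕ) → List (Vec A n)
allVecs xs zero = [] ∷ []
allVecs xs (suc n) = concatMap (λ x → List.map (x ∷_) (allVecs xs n)) xs

allFin : (n : ℕ) → List (Fin n)
allFin zero = []
allFin (suc n) = zero ∷ List.map suc (allFin n)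

allB : {A : Set} → (A → Bool) → List A → Bool
allB p [] = true
allB p (x ∷ xs) = p x ∧ allB p xs

anyB : {A : Set} → (A → Bool) → List A → Bool
anyB p [] = false
anyB p (x ∷ xs) = p x ∨ anyB p xs

count : {A : Set} → (A → Bool) → List A → ℕ
count p xs = List.length (List.filter (λ x → Data.Bool.T? (p x)) xs)
  where import Data.Bool

Σℚ : List ℚ → ℚ
Σℚ = List.foldr _+_ 0ℚ

ℕ→ℚ : ℕ → ℚ
ℕ→ℚ k = + k ℚ./ 1

sign : ℕ → ℚ
sign zero = 1ℚ
sign (suc k) = - sign k

binom : ℚ → ℕ → ℚ
binom a zero = 1ℚ
binom a (suc i) = binom a i * (a - ℕ→ℚ i) * (+ 1 ℚ./ suc i)

-- Formal power series over ℚ in N variables x₁,…,x_N: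
-- coefficient functions on monomial exponent vectors.

Mon : ℕ → Set
Mon N = Vec ℕ N

Series : ℕ → Set
Series N = Mon N → ℚ

deg : {N : ℕ} → Mon N → ℕ
deg = Vec.sum

record Split (N : ℕ) : Set where
  constructor split
  field
    fst : Mon N
    snd : Mon N

splits : {N : ℕ} → Mon N → List (Split N)
splits [] = split [] [] ∷ []
splits (k ∷ m) =
  concatMap (λ i → List.map (λ s → split (i ∷ Split.fst s) ((k ℕ.∸ i) ∷ Split.snd s))
                            (splits m))
            (upTo (suc k))

oneS : {N : ℕ} → Series N
oneS m = if isZero m then 1ℚ else 0ℚ
  where
  isZero : {N : ℕ} → Mon N → Bool
  isZero [] = true
  isZero (zero ∷ m) = isZero m
  isZero (suc _ ∷ m) = false

_+S_ : {N : ℕ} → Series N → Series N → Series N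
(f +S g) m = f m + g m

_*S_ : {N : ℕ} → Series N → Series N → Series N
(f *S g) m = Σℚ (List.map (λ s → f (Split.fst s) * g (Split.snd s)) (splits m))

_^S_ : {N : ℕ} → Series N → ℕ → Series N
f ^S zero = oneS
f ^S suc i = f *S (f ^S i)

-- (1+u)^a := Σ_{i≥0} binom a i · u^i, for a series u with zero constant
-- term; the coefficient at m only receives contributions from i ≤ deg m.
onePlusPow : {N : ℕ} → Series N → ℚ → Series N
onePlusPow u a m =
  Σℚ (List.map (λ i → binom a i * (u ^S i) m) (upTo (suc (deg m))))

prodUpTo : {N : ℕ} → (ℕ → Series N) → ℕ → Series N
prodUpTo F zero = oneS
prodUpTo F (suc K) = prodUpTo F K *S F (suc K)

-- infinite product ∏_{k≥1} F k, for factors with F k ≡ 1 modulo terms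
-- of total degree ≥ k: the coefficient at m is that of the finite
-- product up to k = deg m (the coefficients stabilise from there on).
infProd : {N : ℕ} → (ℕ → Series N) → Series N
infProd F m = prodUpTo F (deg m) m

tPow : ℕ → Series 1
tPow k (d ∷ []) = if d ℕ.≡ᵇ k then 1ℚ else 0ℚ

wtOf : {n : ℕ} → PosWeight n → Subset n → ℕ
wtOf {n} ω S = NL.sum (List.map (λ v → if lookup S v then wt ω v else 0) (allFin n))

isIndep : {n : ℕ} → Graph n → Subset n → Bool
isIndep {n} G S =
  allB (λ u → allB (λ v → not (lookup S u ∧ lookup S v ∧ adj G u v)) (allFin n))
       (allFin n)

_⊆B_ : {n : ℕ} → Subset n → Subset n → Bool
_⊆B_ {n} S W = allB (λ v → not (lookup S v) ∨ lookup W v) (allFin n)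

-- independence polynomial of the induced weighted subgraph (G|_W, ω):
-- coefficient of t^d = number of independent sets S ⊆ W of G with ω(S) = d
-- (independent sets of G|_W are exactly independent sets of G inside W)
indepPoly : {n : ℕ} → Graph n → PosWeight n → Subset n → Series 1
indepPoly {n} G ω W (d ∷ []) =
  ℕ→ℚ (count (λ S → (S ⊆B W) ∧ isIndep G S ∧ (wtOf ω S ℕ.≡ᵇ d)) (allSubsets n))

-- Kromatic symmetric function, restricted to the variables x₁,…,x_N
-- (i.e. with x_i = 0 for i > N). A set colouring using only colours in
-- {1,…,N} is α : V → Subset N.

nonEmptyB : {N : ℕ} → Subset N → Bool
nonEmptyB {N} c = anyB (lookup c) (allFin N)

properB : {n N : ℕ} → Graph n → Vec (Subset N) n → Bool
properB {n} {N} G α =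
  allB (λ v → nonEmptyB (lookup α v)) (allFin n) ∧
  allB (λ u → allB (λ v →
      not (adj G u v ∧ anyB (λ i → lookup (lookup α u) i ∧ lookup (lookup α v) i)
                            (allFin N)))
    (allFin n)) (allFin n)

monOf : {n N : ℕ} → PosWeight n → Vec (Subset N) n → Mon N
monOf {n} {N} ω α =
  Vec.tabulate (λ i → NL.sum (List.map
    (λ v → if lookup (lookup α v) i then wt ω v else 0) (allFin n)))

monEqB : {N : ℕ} → Mon N → Mon N → Bool
monEqB [] [] = true
monEqB (a ∷ m) (b ∷ m') = (a ℕ.≡ᵇ b) ∧ monEqB m m'

Kromatic : {n : ℕ} → (N : ℕ) → Graph n → PosWeight n → Series N
Kromatic {n} N G ω m =
  ℕ→ℚ (count (λ α → properB G α ∧ monEqB (monOf ω α) m)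
             (allVecs (allSubsets N) n))

edgeless : (n : ℕ) → Graph n
edgeless n = record { adj = λ _ _ → false ; sym = λ _ _ → Relation.Binary.PropositionalEquality.refl ; irrefl = λ _ → Relation.Binary.PropositionalEquality.refl }

weight1 : (k : ℕ) → 0 < k → PosWeight 1
weight1 k p = record { wt = λ _ → k ; pos = λ _ → p }

pbar : (N : ℕ) → (k : ℕ) → .{{_ : ℕ.NonZero k}} → Series N
pbar N (suc k) = Kromatic N (edgeless 1) (weight1 (suc k) (ℕ.s≤s ℕ.z≤n))

-- factor indexed by k ≥ 1, written with k = suc j; index 0 unused
pbarFactor : (N : ℕ) → (ℕ → ℚ) → ℕ → Series N
pbarFactor N a zero = oneS
pbarFactor N a (suc j) = onePlusPow (pbar N (suc j)) (a (suc j))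

tFactor : (ℕ → ℚ) → ℕ → Series 1
tFactor a zero = oneS
tFactor a (suc j) = onePlusPow (tPow (suc j)) (a (suc j))

IsExponents : {n : ℕ} → Graph n → PosWeight n → Subset n → (ℕ → ℚ) → Set
IsExponents G ω W a = ∀ (d : Mon 1) → infProd (tFactor a) d ≡ indepPoly G ω W d

module Submission where

-- Drop the requirement that colour sets be nonempty. A weak colouring of G
-- with colours 1, …, N that is supported in W is the same as an N-tuple of
-- independent sets of G|_W (its colour classes), so these colourings are
-- counted by I_W(x_1) ⋯ I_W(x_N). Inclusion–exclusion over the support W
-- restores nonemptiness and produces the signs (-1)^|V∖W|.
-- On the other side 1 + p̄_k = ∏_i (1 + x_i^k), and (1 + U)^a = (1 + x)^a (1 + y)^a
-- whenever 1 + U = (1 + x)(1 + y): for natural a this is the binomial theorem,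
-- and both sides are polynomials in a, so it holds for every rational a. Hence
-- ∏_k (1 + p̄_k)^(a_W(k)) = ∏_i ∏_k (1 + x_i^k)^(a_W(k)) = ∏_i I_W(x_i).

open import Defs hiding (sym)
open import Data.Nat using (ℕ)
open import Data.Rational using (ℚ)
open import Data.Fin.Subset using (Subset; ∣_∣; ∁)
open import Data.List using (map)
open import Relation.Binary.PropositionalEquality using (_≡_)

open import Algebra.Bundles using (CommutativeMonoid)
import Algebra.Properties.CommutativeSemigroup as CommSemigroupProperties
open import Data.Bool using (Bool; true; false; _∧_; _∨_; not; if_then_else_)
import Data.Bool.Properties as BoolP
open import Data.Bool.Solver using (module ∨-∧-Solver)
open import Data.Empty using (⊥-elim)
open import Data.Fin as Fin using (Fin)
import Data.Integer as ℤ
import Data.Integer.Properties as ℤP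
open import Data.List as List using (List; []; _∷_; _++_; concatMap; upTo; applyUpTo)
import Data.List.Properties as ListP
open import Data.List.Relation.Unary.All as All using (All; []; _∷_)
import Data.List.Relation.Unary.All.Properties as AllP
open import Data.Nat as ℕ using (zero; suc; _∸_; _≤_; _<_; z≤n; s≤s)
import Data.Nat.Coprimality as Coprime
import Data.Nat.ListAction as NL
import Data.Nat.Properties as ℕP
open import Data.Rational as ℚ using (0ℚ; 1ℚ; _+_; _*_; _-_; -_; _/_; 1/_)
import Data.Rational.Properties as ℚP
open import Data.Rational.Solver using (module +-*-Solver)
import Data.Rational.Unnormalised as ℚᵘ
import Data.Rational.Unnormalised.Properties as ℚᵘP
open import Data.Sum using (inj₁; inj₂)
open import Data.Vec as Vec using (Vec; []; _∷_; lookup)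
import Data.Vec.Properties as VecP
open import Function using (_∘_)
open import Relation.Binary.PropositionalEquality
  using (refl; sym; trans; cong; cong₂; subst; _≢_; _≗_; module ≡-Reasoning)
open import Relation.Nullary using (yes; no)

open +-*-Solver using (solve; _:+_; _:*_; _:-_; :-_; _:=_; con)

private
  module ℚ+ = CommSemigroupProperties (CommutativeMonoid.commutativeSemigroup ℚP.+-0-commutativeMonoid)
  module ℚ* = CommSemigroupProperties (CommutativeMonoid.commutativeSemigroup ℚP.*-1-commutativeMonoid)
  module ℕ+ = CommSemigroupProperties ℕP.+-commutativeSemigroup
  module 𝔹∧ = CommSemigroupProperties (CommutativeMonoid.commutativeSemigroup BoolP.∧-commutativeMonoid)

private
  variable
    A B : Set
    N : ℕ
    φ ψ : ℚ → ℚ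

module _ where
  open ℚᵘP.≃-Reasoning

  ℕ→ℚ-suc : ∀ k → ℕ→ℚ (suc k) ≡ 1ℚ + ℕ→ℚ k
  ℕ→ℚ-suc k = ℚP.toℚᵘ-injective (begin
    ℚ.toℚᵘ (ℕ→ℚ (suc k))              ≈⟨ ℚP.toℚᵘ-fromℚᵘ (ℚᵘ.mkℚᵘ (ℤ.+ suc k) 0) ⟩
    ℚᵘ.mkℚᵘ (ℤ.+ suc k) 0              ≈⟨ ℚᵘ.*≡* (cross-multiplied (ℤ.+ k)) ⟩
    ℚᵘ.1ℚᵘ ℚᵘ.+ ℚᵘ.mkℚᵘ (ℤ.+ k) 0      ≈⟨ ℚᵘP.+-congʳ ℚᵘ.1ℚᵘ (ℚᵘP.≃-sym (ℚP.toℚᵘ-fromℚᵘ (ℚᵘ.mkℚᵘ (ℤ.+ k) 0))) ⟩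
    ℚ.toℚᵘ 1ℚ ℚᵘ.+ ℚ.toℚᵘ (ℕ→ℚ k)      ≈⟨ ℚᵘP.≃-sym (ℚP.toℚᵘ-homo-+ 1ℚ (ℕ→ℚ k)) ⟩
    ℚ.toℚᵘ (1ℚ + ℕ→ℚ k)                ∎)
    where
    cross-multiplied : ∀ k → (ℤ.+ 1 ℤ.+ k) ℤ.* (ℤ.+ 1 ℤ.* ℤ.+ 1) ≡ (ℤ.+ 1 ℤ.* ℤ.+ 1 ℤ.+ k ℤ.* ℤ.+ 1) ℤ.* ℤ.+ 1
    cross-multiplied k = trans (ℤP.*-identityʳ _) (sym (trans (ℤP.*-identityʳ _) (cong (λ x → ℤ.+ 1 ℤ.+ x) (ℤP.*-identityʳ k))))

1/suc-inverse : ∀ i → (ℤ.+ 1 / suc i) * ℕ→ℚ (suc i) ≡ 1ℚ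
1/suc-inverse i = trans (cong₂ _*_ (ℚP.↥p/↧p≡p (1/ n)) (ℚP.↥p/↧p≡p n)) (ℚP.*-inverseˡ n)
  where
  n : ℚ
  n = ℚ.mkℚ (ℤ.+ suc i) 0 (Coprime.sym (Coprime.1-coprimeTo (suc i)))

open ≡-Reasoning

∑ : List A → (A → ℚ) → ℚ
∑ xs f = Σℚ (List.map f xs)

infix 5 ∑
syntax ∑ xs (λ x → e) = ∑[ x ∈ xs ] e

∑-cong : (xs : List A) {f g : A → ℚ} → f ≗ g → ∑ xs f ≡ ∑ xs g
∑-cong []       f≗g = refl
∑-cong (x ∷ xs) f≗g = cong₂ _+_ (f≗g x) (∑-cong xs f≗g)

∑-zero : {xs : List A} {f : A → ℚ} → All (λ x → f x ≡ 0ℚ) xs → ∑ xs f ≡ 0ℚ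
∑-zero []           = refl
∑-zero (fx≡0 ∷ f≡0) = cong₂ _+_ fx≡0 (∑-zero f≡0)

∑-++ : (xs ys : List A) (f : A → ℚ) → ∑ (xs ++ ys) f ≡ ∑ xs f + ∑ ys f
∑-++ []       ys f = sym (ℚP.+-identityˡ _)
∑-++ (x ∷ xs) ys f = trans (cong (f x +_) (∑-++ xs ys f)) (sym (ℚP.+-assoc (f x) _ _))

∑-map : (h : A → B) (xs : List A) (f : B → ℚ) → ∑ (List.map h xs) f ≡ ∑ xs (f ∘ h)
∑-map h []       f = refl
∑-map h (x ∷ xs) f = cong (f (h x) +_) (∑-map h xs f)

∑-concatMap : (g : A → List B) (xs : List A) (f : B → ℚ) →
              ∑ (concatMap g xs) f ≡ ∑[ x ∈ xs ] ∑ (g x) f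
∑-concatMap g []       f = refl
∑-concatMap g (x ∷ xs) f =
  trans (∑-++ (g x) (concatMap g xs) f) (cong (∑ (g x) f +_) (∑-concatMap g xs f))

∑-distrib-+ : (xs : List A) (f g : A → ℚ) → ∑[ x ∈ xs ] (f x + g x) ≡ ∑ xs f + ∑ xs g
∑-distrib-+ []       f g = refl
∑-distrib-+ (x ∷ xs) f g =
  trans (cong ((f x + g x) +_) (∑-distrib-+ xs f g)) (ℚ+.interchange (f x) (g x) (∑ xs f) (∑ xs g))

*-distribˡ-∑ : (c : ℚ) (xs : List A) (f : A → ℚ) → c * ∑ xs f ≡ ∑[ x ∈ xs ] (c * f x)
*-distribˡ-∑ c []       f = ℚP.*-zeroʳ c
*-distribˡ-∑ c (x ∷ xs) f =
  trans (ℚP.*-distribˡ-+ c (f x) (∑ xs f)) (cong (c * f x +_) (*-distribˡ-∑ c xs f))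

*-distribʳ-∑ : (c : ℚ) (xs : List A) (f : A → ℚ) → ∑ xs f * c ≡ ∑[ x ∈ xs ] (f x * c)
*-distribʳ-∑ c xs f =
  trans (ℚP.*-comm _ c) (trans (*-distribˡ-∑ c xs f) (∑-cong xs (λ x → ℚP.*-comm c (f x))))

neg-distrib-∑ : (xs : List A) (f : A → ℚ) → ∑[ x ∈ xs ] (- f x) ≡ - ∑ xs f
neg-distrib-∑ []       f = refl
neg-distrib-∑ (x ∷ xs) f =
  trans (cong (- f x +_) (neg-distrib-∑ xs f)) (sym (ℚP.neg-distrib-+ (f x) (∑ xs f)))

∑-const-0 : (xs : List A) → ∑[ x ∈ xs ] 0ℚ ≡ 0ℚ
∑-const-0 xs = ∑-zero (All.universal (λ _ → refl) xs)

∑-comm : (xs : List A) (ys : List B) (f : A → B → ℚ) →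
         ∑[ x ∈ xs ] ∑[ y ∈ ys ] f x y ≡ ∑[ y ∈ ys ] ∑[ x ∈ xs ] f x y
∑-comm []       ys f = sym (∑-const-0 ys)
∑-comm (x ∷ xs) ys f =
  trans (cong (∑ ys (f x) +_) (∑-comm xs ys f)) (sym (∑-distrib-+ ys (f x) (λ y → ∑[ x′ ∈ xs ] f x′ y)))

∑-applyUpTo : (n : ℕ) (h : ℕ → ℕ) (g : ℕ → ℚ) → ∑ (applyUpTo h n) g ≡ ∑ (upTo n) (g ∘ h)
∑-applyUpTo zero    h g = refl
∑-applyUpTo (suc n) h g =
  cong (g (h 0) +_) (trans (∑-applyUpTo n (h ∘ suc) g) (sym (∑-applyUpTo n suc (g ∘ h))))

∑-upTo-suc : (n : ℕ) (g : ℕ → ℚ) → ∑ (upTo (suc n)) g ≡ g 0 + ∑ (upTo n) (g ∘ suc)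
∑-upTo-suc n g = cong (g 0 +_) (∑-applyUpTo n suc g)

∑-upTo-snoc : (n : ℕ) (g : ℕ → ℚ) → ∑ (upTo (suc n)) g ≡ ∑ (upTo n) g + g n
∑-upTo-snoc zero    g = trans (ℚP.+-identityʳ (g 0)) (sym (ℚP.+-identityˡ (g 0)))
∑-upTo-snoc (suc n) g = begin
  ∑ (upTo (suc (suc n))) g                  ≡⟨ ∑-upTo-suc (suc n) g ⟩
  g 0 + ∑ (upTo (suc n)) (g ∘ suc)          ≡⟨ cong (g 0 +_) (∑-upTo-snoc n (g ∘ suc)) ⟩
  g 0 + (∑ (upTo n) (g ∘ suc) + g (suc n))  ≡⟨ sym (ℚP.+-assoc (g 0) _ _) ⟩
  (g 0 + ∑ (upTo n) (g ∘ suc)) + g (suc n)  ≡⟨ cong (_+ g (suc n)) (sym (∑-upTo-suc n g)) ⟩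
  ∑ (upTo (suc n)) g + g (suc n)            ∎

∑-upTo-cong : (n : ℕ) {f g : ℕ → ℚ} → (∀ i → i < n → f i ≡ g i) → ∑ (upTo n) f ≡ ∑ (upTo n) g
∑-upTo-cong zero    f≡g = refl
∑-upTo-cong (suc n) {f} {g} f≡g = begin
  ∑ (upTo (suc n)) f ≡⟨ ∑-upTo-snoc n f ⟩
  ∑ (upTo n) f + f n ≡⟨ cong₂ _+_ (∑-upTo-cong n (λ i i<n → f≡g i (ℕP.m<n⇒m<1+n i<n))) (f≡g n ℕP.≤-refl) ⟩
  ∑ (upTo n) g + g n ≡⟨ sym (∑-upTo-snoc n g) ⟩
  ∑ (upTo (suc n)) g ∎

∑-upTo-zero : (n : ℕ) {g : ℕ → ℚ} → (∀ i → i < n → g i ≡ 0ℚ) → ∑ (upTo n) g ≡ 0ℚ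
∑-upTo-zero n g≡0 = trans (∑-upTo-cong n g≡0) (∑-const-0 (upTo n))

∑-upTo-extend : (n L : ℕ) (g : ℕ → ℚ) → n ≤ L → (∀ i → n ≤ i → i < L → g i ≡ 0ℚ) → ∑ (upTo L) g ≡ ∑ (upTo n) g
∑-upTo-extend n zero    g z≤n g≡0 = refl
∑-upTo-extend n (suc L) g n≤1+L g≡0 with ℕP.m≤n⇒m<n∨m≡n n≤1+L
... | inj₂ refl = refl
... | inj₁ (s≤s n≤L) = begin
  ∑ (upTo (suc L)) g  ≡⟨ ∑-upTo-snoc L g ⟩
  ∑ (upTo L) g + g L  ≡⟨ cong₂ _+_ (∑-upTo-extend n L g n≤L (λ i n≤i i<L → g≡0 i n≤i (ℕP.m<n⇒m<1+n i<L)))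
                                   (g≡0 L n≤L ℕP.≤-refl) ⟩
  ∑ (upTo n) g + 0ℚ   ≡⟨ ℚP.+-identityʳ _ ⟩
  ∑ (upTo n) g        ∎

∑-upTo-shift : (n : ℕ) (g : ℕ → ℚ) → g 0 ≡ 0ℚ → g n ≡ 0ℚ → ∑ (upTo n) g ≡ ∑ (upTo n) (g ∘ suc)
∑-upTo-shift n g g0≡0 gn≡0 = begin
  ∑ (upTo n) g                 ≡⟨ sym (∑-upTo-extend n (suc n) g (ℕP.n≤1+n n) tail≡0) ⟩
  ∑ (upTo (suc n)) g           ≡⟨ ∑-upTo-suc n g ⟩
  g 0 + ∑ (upTo n) (g ∘ suc)   ≡⟨ cong (_+ ∑ (upTo n) (g ∘ suc)) g0≡0 ⟩
  0ℚ + ∑ (upTo n) (g ∘ suc)    ≡⟨ ℚP.+-identityˡ _ ⟩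
  ∑ (upTo n) (g ∘ suc)         ∎
  where
  tail≡0 : ∀ i → n ≤ i → i < suc n → g i ≡ 0ℚ
  tail≡0 i n≤i i<1+n = subst (λ j → g j ≡ 0ℚ) (ℕP.≤-antisym n≤i (ℕP.≤-pred i<1+n)) gn≡0

∑-allSubsets-suc : (f : Subset (suc N) → ℚ) →
  ∑ (allSubsets (suc N)) f ≡ (∑[ c ∈ allSubsets N ] f (true ∷ c)) + (∑[ c ∈ allSubsets N ] f (false ∷ c))
∑-allSubsets-suc {N} f = trans (∑-++ (List.map (true ∷_) (allSubsets N)) _ f)
                               (cong₂ _+_ (∑-map (true ∷_) (allSubsets N) f) (∑-map (false ∷_) (allSubsets N) f))

∑-allVecs-suc : (xs : List A) (n : ℕ) (f : Vec A (suc n) → ℚ) →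
                ∑ (allVecs xs (suc n)) f ≡ ∑[ x ∈ xs ] ∑[ α ∈ allVecs xs n ] f (x ∷ α)
∑-allVecs-suc xs n f = trans (∑-concatMap (λ x → List.map (x ∷_) (allVecs xs n)) xs f)
                             (∑-cong xs (λ x → ∑-map (x ∷_) (allVecs xs n) f))

∑-allVecs-singleton : (x : A) (n : ℕ) (g : Vec A n → ℚ) → ∑ (allVecs (x ∷ []) n) g ≡ g (Vec.replicate n x)
∑-allVecs-singleton x zero    g = ℚP.+-identityʳ (g [])
∑-allVecs-singleton x (suc n) g =
  trans (∑-allVecs-suc (x ∷ []) n g) (trans (ℚP.+-identityʳ _) (∑-allVecs-singleton x n (λ α → g (x ∷ α))))

suc*binom-suc : ∀ a i → ℕ→ℚ (suc i) * binom a (suc i) ≡ (a - ℕ→ℚ i) * binom a i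
suc*binom-suc a i = begin
  J * (binom a i * (a - ℕ→ℚ i) * r)    ≡⟨ rearrange J (binom a i) (a - ℕ→ℚ i) r ⟩
  (r * J) * ((a - ℕ→ℚ i) * binom a i)  ≡⟨ cong (_* ((a - ℕ→ℚ i) * binom a i)) (1/suc-inverse i) ⟩
  1ℚ * ((a - ℕ→ℚ i) * binom a i)       ≡⟨ ℚP.*-identityˡ _ ⟩
  (a - ℕ→ℚ i) * binom a i              ∎
  where
  J = ℕ→ℚ (suc i)
  r = ℤ.+ 1 / suc i
  rearrange : ∀ j b x r → j * (b * x * r) ≡ (r * j) * (x * b)
  rearrange = solve 4 (λ j b x r → j :* (b :* x :* r) := (r :* j) :* (x :* b)) refl

*-cancelˡ-suc : ∀ i {x y} → ℕ→ℚ (suc i) * x ≡ ℕ→ℚ (suc i) * y → x ≡ y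
*-cancelˡ-suc i {x} {y} eq = begin
  x            ≡⟨ sym (ℚP.*-identityˡ x) ⟩
  1ℚ * x       ≡⟨ cong (_* x) (sym (1/suc-inverse i)) ⟩
  (r * J) * x  ≡⟨ ℚP.*-assoc r J x ⟩
  r * (J * x)  ≡⟨ cong (r *_) eq ⟩
  r * (J * y)  ≡⟨ sym (ℚP.*-assoc r J y) ⟩
  (r * J) * y  ≡⟨ cong (_* y) (1/suc-inverse i) ⟩
  1ℚ * y       ≡⟨ ℚP.*-identityˡ y ⟩
  y            ∎
  where
  J = ℕ→ℚ (suc i)
  r = ℤ.+ 1 / suc i

binom-pascal : ∀ a i → binom (1ℚ + a) (suc i) ≡ binom a (suc i) + binom a i
binom-pascal a zero = solve 1 (λ a → (con 1ℚ :* ((con 1ℚ :+ a) :- con 0ℚ)) :* con 1ℚ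
                                    := (con 1ℚ :* (a :- con 0ℚ)) :* con 1ℚ :+ con 1ℚ) refl a
binom-pascal a (suc i) = *-cancelˡ-suc (suc i) (begin
  I₂ * binom (1ℚ + a) (suc (suc i))          ≡⟨ suc*binom-suc (1ℚ + a) (suc i) ⟩
  ((1ℚ + a) - I₁) * binom (1ℚ + a) (suc i)   ≡⟨ cong₂ (λ x y → ((1ℚ + a) - x) * y) (ℕ→ℚ-suc i) (binom-pascal a i) ⟩
  ((1ℚ + a) - (1ℚ + I₀)) * (B₁ + B₀)         ≡⟨ expand a I₀ B₁ B₀ ⟩
  (a - I₀) * B₁ + (a - I₀) * B₀              ≡⟨ cong ((a - I₀) * B₁ +_) (sym (suc*binom-suc a i)) ⟩
  (a - I₀) * B₁ + I₁ * B₁                    ≡⟨ cong (λ x → (a - I₀) * B₁ + x * B₁) (ℕ→ℚ-suc i) ⟩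
  (a - I₀) * B₁ + (1ℚ + I₀) * B₁             ≡⟨ regroup a I₀ B₁ ⟩
  (a - (1ℚ + I₀)) * B₁ + (1ℚ + (1ℚ + I₀)) * B₁ ≡⟨ cong₂ (λ x y → (a - x) * B₁ + y * B₁) (sym (ℕ→ℚ-suc i))
                                                        (sym (trans (ℕ→ℚ-suc (suc i)) (cong (1ℚ +_) (ℕ→ℚ-suc i)))) ⟩
  (a - I₁) * B₁ + I₂ * B₁                    ≡⟨ cong (_+ I₂ * B₁) (sym (suc*binom-suc a (suc i))) ⟩
  I₂ * binom a (suc (suc i)) + I₂ * B₁       ≡⟨ sym (ℚP.*-distribˡ-+ I₂ _ B₁) ⟩
  I₂ * (binom a (suc (suc i)) + B₁)          ∎)
  where
  I₀ = ℕ→ℚ i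
  I₁ = ℕ→ℚ (suc i)
  I₂ = ℕ→ℚ (suc (suc i))
  B₀ = binom a i
  B₁ = binom a (suc i)
  expand : ∀ a i b₁ b₀ → ((1ℚ + a) - (1ℚ + i)) * (b₁ + b₀) ≡ (a - i) * b₁ + (a - i) * b₀
  expand = solve 4 (λ a i b₁ b₀ → ((con 1ℚ :+ a) :- (con 1ℚ :+ i)) :* (b₁ :+ b₀)
                                  := (a :- i) :* b₁ :+ (a :- i) :* b₀) refl
  regroup : ∀ a i b → (a - i) * b + (1ℚ + i) * b ≡ (a - (1ℚ + i)) * b + (1ℚ + (1ℚ + i)) * b
  regroup = solve 3 (λ a i b → (a :- i) :* b :+ (con 1ℚ :+ i) :* b
                              := (a :- (con 1ℚ :+ i)) :* b :+ (con 1ℚ :+ (con 1ℚ :+ i)) :* b) refl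

binom-ℕ-vanish : ∀ n i → n < i → binom (ℕ→ℚ n) i ≡ 0ℚ
binom-ℕ-vanish n (suc i) n<1+i with ℕP.m≤n⇒m<n∨m≡n (ℕP.≤-pred n<1+i)
... | inj₁ n<i = begin
  binom (ℕ→ℚ n) i * (ℕ→ℚ n - ℕ→ℚ i) * r ≡⟨ cong (λ b → b * (ℕ→ℚ n - ℕ→ℚ i) * r) (binom-ℕ-vanish n i n<i) ⟩
  0ℚ * (ℕ→ℚ n - ℕ→ℚ i) * r              ≡⟨ cong (_* r) (ℚP.*-zeroˡ (ℕ→ℚ n - ℕ→ℚ i)) ⟩
  0ℚ * r                                 ≡⟨ ℚP.*-zeroˡ r ⟩
  0ℚ                                     ∎
  where r = ℤ.+ 1 / suc i
... | inj₂ refl = begin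
  binom (ℕ→ℚ n) n * (ℕ→ℚ n - ℕ→ℚ n) * r ≡⟨ cong (λ x → binom (ℕ→ℚ n) n * x * r) (ℚP.+-inverseʳ (ℕ→ℚ n)) ⟩
  binom (ℕ→ℚ n) n * 0ℚ * r               ≡⟨ cong (_* r) (ℚP.*-zeroʳ (binom (ℕ→ℚ n) n)) ⟩
  0ℚ * r                                 ≡⟨ ℚP.*-zeroˡ r ⟩
  0ℚ                                     ∎
  where r = ℤ.+ 1 / suc n

*-binom : ∀ a i → a * binom a i ≡ ℕ→ℚ (suc i) * binom a (suc i) + ℕ→ℚ i * binom a i
*-binom a i = begin
  a * binom a i                                    ≡⟨ peel a (ℕ→ℚ i) (binom a i) ⟩
  (a - ℕ→ℚ i) * binom a i + ℕ→ℚ i * binom a i      ≡⟨ cong (_+ ℕ→ℚ i * binom a i) (sym (suc*binom-suc a i)) ⟩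
  ℕ→ℚ (suc i) * binom a (suc i) + ℕ→ℚ i * binom a i ∎
  where
  peel : ∀ a i b → a * b ≡ (a - i) * b + i * b
  peel = solve 3 (λ a i b → a :* b := (a :- i) :* b :+ i :* b) refl

⟦_⟧ : Bool → ℚ
⟦ true  ⟧ = 1ℚ
⟦ false ⟧ = 0ℚ

⟦∧⟧ : ∀ a b → ⟦ a ∧ b ⟧ ≡ ⟦ a ⟧ * ⟦ b ⟧
⟦∧⟧ true  b = sym (ℚP.*-identityˡ ⟦ b ⟧)
⟦∧⟧ false b = sym (ℚP.*-zeroˡ ⟦ b ⟧)

if-1-0≡⟦⟧ : ∀ b → (if b then 1ℚ else 0ℚ) ≡ ⟦ b ⟧
if-1-0≡⟦⟧ true  = refl
if-1-0≡⟦⟧ false = refl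

⟦≡ᵇ⟧-refl : ∀ n → ⟦ n ℕ.≡ᵇ n ⟧ ≡ 1ℚ
⟦≡ᵇ⟧-refl zero    = refl
⟦≡ᵇ⟧-refl (suc n) = ⟦≡ᵇ⟧-refl n

⟦≡ᵇ⟧-≢ : ∀ m n → m ≢ n → ⟦ m ℕ.≡ᵇ n ⟧ ≡ 0ℚ
⟦≡ᵇ⟧-≢ zero    zero    m≢n = ⊥-elim (m≢n refl)
⟦≡ᵇ⟧-≢ zero    (suc n) m≢n = refl
⟦≡ᵇ⟧-≢ (suc m) zero    m≢n = refl
⟦≡ᵇ⟧-≢ (suc m) (suc n) m≢n = ⟦≡ᵇ⟧-≢ m n (m≢n ∘ cong suc)

≡ᵇ-comm : ∀ m n → (m ℕ.≡ᵇ n) ≡ (n ℕ.≡ᵇ m)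
≡ᵇ-comm zero    zero    = refl
≡ᵇ-comm zero    (suc n) = refl
≡ᵇ-comm (suc m) zero    = refl
≡ᵇ-comm (suc m) (suc n) = ≡ᵇ-comm m n

count≡∑⟦⟧ : (p : A → Bool) (xs : List A) → ℕ→ℚ (count p xs) ≡ ∑[ x ∈ xs ] ⟦ p x ⟧
count≡∑⟦⟧ p []       = refl
count≡∑⟦⟧ p (x ∷ xs) with p x
... | true  = trans (ℕ→ℚ-suc (count p xs)) (cong (1ℚ +_) (count≡∑⟦⟧ p xs))
... | false = trans (count≡∑⟦⟧ p xs) (sym (ℚP.+-identityˡ _))

allB-allFin-suc : {n : ℕ} (p : Fin (suc n) → Bool) → allB p (allFin (suc n)) ≡ p Fin.zero ∧ allB (p ∘ Fin.suc) (allFin n)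
allB-allFin-suc {n} p = cong (p Fin.zero ∧_) (allB-map-suc (allFin n))
  where
  allB-map-suc : (xs : List (Fin n)) → allB p (List.map Fin.suc xs) ≡ allB (p ∘ Fin.suc) xs
  allB-map-suc []       = refl
  allB-map-suc (x ∷ xs) = cong (p (Fin.suc x) ∧_) (allB-map-suc xs)

anyB-allFin-suc : {n : ℕ} (p : Fin (suc n) → Bool) → anyB p (allFin (suc n)) ≡ p Fin.zero ∨ anyB (p ∘ Fin.suc) (allFin n)
anyB-allFin-suc {n} p = cong (p Fin.zero ∨_) (anyB-map-suc (allFin n))
  where
  anyB-map-suc : (xs : List (Fin n)) → anyB p (List.map Fin.suc xs) ≡ anyB (p ∘ Fin.suc) xs
  anyB-map-suc []       = refl
  anyB-map-suc (x ∷ xs) = cong (p (Fin.suc x) ∨_) (anyB-map-suc xs)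

nonEmptyB-∷ : (b : Bool) (c : Subset N) → nonEmptyB (b ∷ c) ≡ b ∨ nonEmptyB c
nonEmptyB-∷ b c = anyB-allFin-suc (lookup (b ∷ c))

allB-cong : {p q : A → Bool} (xs : List A) → p ≗ q → allB p xs ≡ allB q xs
allB-cong []       p≗q = refl
allB-cong (x ∷ xs) p≗q = cong₂ _∧_ (p≗q x) (allB-cong xs p≗q)

allB-∧ : (p q : A → Bool) (xs : List A) → allB (λ x → p x ∧ q x) xs ≡ allB p xs ∧ allB q xs
allB-∧ p q []       = refl
allB-∧ p q (x ∷ xs) = trans (cong ((p x ∧ q x) ∧_) (allB-∧ p q xs)) (𝔹∧.interchange (p x) (q x) (allB p xs) (allB q xs))

allB-true : (xs : List A) → allB (λ _ → true) xs ≡ true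
allB-true []       = refl
allB-true (x ∷ xs) = allB-true xs

-- Polynomials in the Newton basis binom a i

newton : (ℕ → ℚ) → ℕ → ℚ → ℚ
newton c D a = ∑[ i ∈ upTo D ] c i * binom a i

newton-at-0 : ∀ c D → newton c (suc D) (ℕ→ℚ 0) ≡ c 0
newton-at-0 c D = begin
  newton c (suc D) (ℕ→ℚ 0)                             ≡⟨ ∑-upTo-suc D (λ i → c i * binom (ℕ→ℚ 0) i) ⟩
  c 0 * 1ℚ + (∑[ i ∈ upTo D ] c (suc i) * binom (ℕ→ℚ 0) (suc i)) ≡⟨ cong (c 0 * 1ℚ +_) (∑-upTo-zero D higher≡0) ⟩
  c 0 * 1ℚ + 0ℚ                                        ≡⟨ ℚP.+-identityʳ _ ⟩
  c 0 * 1ℚ                                             ≡⟨ ℚP.*-identityʳ (c 0) ⟩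
  c 0                                                  ∎
  where
  higher≡0 : ∀ i → i < D → c (suc i) * binom (ℕ→ℚ 0) (suc i) ≡ 0ℚ
  higher≡0 i _ = trans (cong (c (suc i) *_) (binom-ℕ-vanish 0 (suc i) (s≤s z≤n))) (ℚP.*-zeroʳ (c (suc i)))

newton-difference : ∀ c D n →
  newton c (suc D) (ℕ→ℚ (suc n)) ≡ newton c (suc D) (ℕ→ℚ n) + newton (c ∘ suc) D (ℕ→ℚ n)
newton-difference c D n = begin
  newton c (suc D) (ℕ→ℚ (suc n))                         ≡⟨ ∑-upTo-suc D (λ i → c i * binom (ℕ→ℚ (suc n)) i) ⟩
  c 0 * 1ℚ + (∑[ i ∈ upTo D ] c (suc i) * binom (ℕ→ℚ (suc n)) (suc i))
    ≡⟨ cong (c 0 * 1ℚ +_) (∑-upTo-cong D (λ i _ → pascal-term i)) ⟩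
  c 0 * 1ℚ + (∑[ i ∈ upTo D ] (c (suc i) * binom x (suc i) + c (suc i) * binom x i))
    ≡⟨ cong (c 0 * 1ℚ +_) (∑-distrib-+ (upTo D) _ _) ⟩
  c 0 * 1ℚ + ((∑[ i ∈ upTo D ] c (suc i) * binom x (suc i)) + newton (c ∘ suc) D x)
    ≡⟨ sym (ℚP.+-assoc (c 0 * 1ℚ) _ _) ⟩
  (c 0 * 1ℚ + (∑[ i ∈ upTo D ] c (suc i) * binom x (suc i))) + newton (c ∘ suc) D x
    ≡⟨ cong (_+ newton (c ∘ suc) D x) (sym (∑-upTo-suc D (λ i → c i * binom x i))) ⟩
  newton c (suc D) x + newton (c ∘ suc) D x              ∎
  where
  x = ℕ→ℚ n
  pascal-term : ∀ i → c (suc i) * binom (ℕ→ℚ (suc n)) (suc i) ≡ c (suc i) * binom x (suc i) + c (suc i) * binom x i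
  pascal-term i = trans (cong (λ y → c (suc i) * binom y (suc i)) (ℕ→ℚ-suc n))
                        (trans (cong (c (suc i) *_) (binom-pascal x i)) (ℚP.*-distribˡ-+ (c (suc i)) _ _))

newton-coeff-vanish : ∀ D c → (∀ n → newton c D (ℕ→ℚ n) ≡ 0ℚ) → ∀ i → i < D → c i ≡ 0ℚ
newton-coeff-vanish (suc D) c vanish zero    _         = trans (sym (newton-at-0 c D)) (vanish 0)
newton-coeff-vanish (suc D) c vanish (suc i) (s≤s i<D) = newton-coeff-vanish D (c ∘ suc) difference-vanish i i<D
  where
  difference-vanish : ∀ n → newton (c ∘ suc) D (ℕ→ℚ n) ≡ 0ℚ
  difference-vanish n = begin
    Δ                                ≡⟨ sym (ℚP.+-identityˡ Δ) ⟩
    0ℚ + Δ                           ≡⟨ cong (_+ Δ) (sym (vanish n)) ⟩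
    newton c (suc D) (ℕ→ℚ n) + Δ     ≡⟨ sym (newton-difference c D n) ⟩
    newton c (suc D) (ℕ→ℚ (suc n))   ≡⟨ vanish (suc n) ⟩
    0ℚ                               ∎
    where Δ = newton (c ∘ suc) D (ℕ→ℚ n)

newton-+ : ∀ c d D a → newton c D a + newton d D a ≡ newton (λ i → c i + d i) D a
newton-+ c d D a = begin
  newton c D a + newton d D a                          ≡⟨ sym (∑-distrib-+ (upTo D) (λ i → c i * binom a i) (λ i → d i * binom a i)) ⟩
  ∑[ i ∈ upTo D ] (c i * binom a i + d i * binom a i)  ≡⟨ ∑-upTo-cong D (λ i _ → sym (ℚP.*-distribʳ-+ (binom a i) (c i) (d i))) ⟩
  newton (λ i → c i + d i) D a                         ∎

*-newton : ∀ k c D a → k * newton c D a ≡ newton (λ i → k * c i) D a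
*-newton k c D a = begin
  k * newton c D a                        ≡⟨ *-distribˡ-∑ k (upTo D) (λ i → c i * binom a i) ⟩
  ∑[ i ∈ upTo D ] k * (c i * binom a i)   ≡⟨ ∑-upTo-cong D (λ i _ → sym (ℚP.*-assoc k (c i) (binom a i))) ⟩
  newton (λ i → k * c i) D a              ∎

record Polynomial (φ : ℚ → ℚ) : Set where
  field
    bound        : ℕ
    coeff        : ℕ → ℚ
    coeff-vanish : ∀ i → bound ≤ i → coeff i ≡ 0ℚ
    expansion    : ∀ a → φ a ≡ newton coeff bound a

  expansion-≤ : ∀ {L} → bound ≤ L → ∀ a → φ a ≡ newton coeff L a
  expansion-≤ {L} bound≤L a = trans (expansion a) (sym (∑-upTo-extend bound L _ bound≤L tail≡0))
    where
    tail≡0 : ∀ i → bound ≤ i → i < L → coeff i * binom a i ≡ 0ℚ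
    tail≡0 i bound≤i _ = trans (cong (_* binom a i) (coeff-vanish i bound≤i)) (ℚP.*-zeroˡ (binom a i))

open Polynomial

polynomial-cong : φ ≗ ψ → Polynomial φ → Polynomial ψ
polynomial-cong φ≗ψ p = record
  { bound = bound p ; coeff = coeff p ; coeff-vanish = coeff-vanish p
  ; expansion = λ a → trans (sym (φ≗ψ a)) (expansion p a) }

polynomial-0 : Polynomial (λ _ → 0ℚ)
polynomial-0 = record
  { bound = 0 ; coeff = λ _ → 0ℚ ; coeff-vanish = λ _ _ → refl ; expansion = λ _ → refl }

polynomial-+ : Polynomial φ → Polynomial ψ → Polynomial (λ a → φ a + ψ a)
polynomial-+ {φ} {ψ} p q = record
  { bound = D ; coeff = c ; coeff-vanish = c-vanish ; expansion = expand }
  where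
  D = bound p ℕ.+ bound q
  c : ℕ → ℚ
  c i = coeff p i + coeff q i
  c-vanish : ∀ i → D ≤ i → c i ≡ 0ℚ
  c-vanish i D≤i = cong₂ _+_ (coeff-vanish p i (ℕP.≤-trans (ℕP.m≤m+n _ _) D≤i))
                             (coeff-vanish q i (ℕP.≤-trans (ℕP.m≤n+m _ _) D≤i))
  expand : ∀ a → φ a + ψ a ≡ newton c D a
  expand a = trans (cong₂ _+_ (expansion-≤ p (ℕP.m≤m+n (bound p) (bound q)) a) (expansion-≤ q (ℕP.m≤n+m (bound q) (bound p)) a))
                   (newton-+ (coeff p) (coeff q) D a)

polynomial-scale : (k : ℚ) → Polynomial φ → Polynomial (λ a → k * φ a)
polynomial-scale {φ} k p = record
  { bound = bound p ; coeff = λ i → k * coeff p i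
  ; coeff-vanish = λ i b≤i → trans (cong (k *_) (coeff-vanish p i b≤i)) (ℚP.*-zeroʳ k)
  ; expansion = λ a → trans (cong (k *_) (expansion p a)) (*-newton k (coeff p) (bound p) a) }

polynomial-binom : ∀ j → Polynomial (λ a → binom a j)
polynomial-binom j = record
  { bound = suc j ; coeff = δ ; coeff-vanish = λ i j<i → ⟦≡ᵇ⟧-≢ i j (ℕP.>⇒≢ j<i) ; expansion = expand }
  where
  δ : ℕ → ℚ
  δ i = ⟦ i ℕ.≡ᵇ j ⟧
  expand : ∀ a → binom a j ≡ newton δ (suc j) a
  expand a = sym (begin
    newton δ (suc j) a                ≡⟨ ∑-upTo-snoc j _ ⟩
    newton δ j a + δ j * binom a j    ≡⟨ cong₂ _+_ (∑-upTo-zero j below-j) (cong (_* binom a j) (⟦≡ᵇ⟧-refl j)) ⟩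
    0ℚ + 1ℚ * binom a j               ≡⟨ ℚP.+-identityˡ _ ⟩
    1ℚ * binom a j                    ≡⟨ ℚP.*-identityˡ _ ⟩
    binom a j                         ∎)
    where
    below-j : ∀ i → i < j → δ i * binom a i ≡ 0ℚ
    below-j i i<j = trans (cong (_* binom a i) (⟦≡ᵇ⟧-≢ i j (ℕP.<⇒≢ i<j))) (ℚP.*-zeroˡ (binom a i))

polynomial-∑-upTo : (n : ℕ) (Φ : ℕ → ℚ → ℚ) → (∀ j → Polynomial (Φ j)) → Polynomial (λ a → ∑[ j ∈ upTo n ] Φ j a)
polynomial-∑-upTo zero    Φ p = polynomial-0
polynomial-∑-upTo (suc n) Φ p =
  polynomial-cong (λ a → sym (∑-upTo-snoc n (λ j → Φ j a))) (polynomial-+ (polynomial-∑-upTo n Φ p) (p n))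

-- from a · binom a i = (i + 1) · binom a (i + 1) + i · binom a i
X*-coeff : (ℕ → ℚ) → ℕ → ℚ
X*-coeff c zero    = 0ℚ
X*-coeff c (suc i) = ℕ→ℚ (suc i) * (c i + c (suc i))

X*-newton : ∀ c D → c D ≡ 0ℚ → ∀ a → a * newton c D a ≡ newton (X*-coeff c) (suc D) a
X*-newton c D cD≡0 a = begin
  a * newton c D a                                     ≡⟨ *-distribˡ-∑ a (upTo D) (λ i → c i * binom a i) ⟩
  ∑[ i ∈ upTo D ] a * (c i * binom a i)                ≡⟨ ∑-upTo-cong D (λ i _ → expand i) ⟩
  ∑[ i ∈ upTo D ] (up i + level i)                     ≡⟨ ∑-distrib-+ (upTo D) up level ⟩
  ∑ (upTo D) up + ∑ (upTo D) level                     ≡⟨ cong (∑ (upTo D) up +_) (∑-upTo-shift D level level-0≡0 level-D≡0) ⟩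
  ∑ (upTo D) up + ∑ (upTo D) (level ∘ suc)             ≡⟨ sym (∑-distrib-+ (upTo D) up (level ∘ suc)) ⟩
  ∑[ i ∈ upTo D ] (up i + level (suc i))               ≡⟨ ∑-upTo-cong D (λ i _ → collect (c i) (c (suc i)) (ℕ→ℚ (suc i)) (binom a (suc i))) ⟩
  ∑[ i ∈ upTo D ] X*-coeff c (suc i) * binom a (suc i) ≡⟨ sym (ℚP.+-identityˡ _) ⟩
  0ℚ + (∑[ i ∈ upTo D ] X*-coeff c (suc i) * binom a (suc i))
                                                       ≡⟨ sym (∑-upTo-suc D (λ i → X*-coeff c i * binom a i)) ⟩
  newton (X*-coeff c) (suc D) a                        ∎
  where
  up level : ℕ → ℚ
  up i    = c i * (ℕ→ℚ (suc i) * binom a (suc i))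
  level i = c i * (ℕ→ℚ i * binom a i)
  expand : ∀ i → a * (c i * binom a i) ≡ up i + level i
  expand i = trans (ℚ*.x∙yz≈y∙xz a (c i) (binom a i)) (trans (cong (c i *_) (*-binom a i)) (ℚP.*-distribˡ-+ (c i) _ _))
  level-0≡0 : level 0 ≡ 0ℚ
  level-0≡0 = trans (cong (c 0 *_) (ℚP.*-zeroˡ 1ℚ)) (ℚP.*-zeroʳ (c 0))
  level-D≡0 : level D ≡ 0ℚ
  level-D≡0 = trans (cong (_* (ℕ→ℚ D * binom a D)) cD≡0) (ℚP.*-zeroˡ (ℕ→ℚ D * binom a D))
  collect : ∀ x y j b → x * (j * b) + y * (j * b) ≡ j * (x + y) * b
  collect = solve 4 (λ x y j b → x :* (j :* b) :+ y :* (j :* b) := j :* (x :+ y) :* b) refl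

polynomial-X* : Polynomial φ → Polynomial (λ a → a * φ a)
polynomial-X* {φ} p = record
  { bound        = suc (bound p)
  ; coeff        = X*-coeff (coeff p)
  ; coeff-vanish = X*-coeff-vanish
  ; expansion    = λ a → trans (cong (a *_) (expansion p a)) (X*-newton (coeff p) (bound p) (coeff-vanish p (bound p) ℕP.≤-refl) a)
  }
  where
  X*-coeff-vanish : ∀ i → suc (bound p) ≤ i → X*-coeff (coeff p) i ≡ 0ℚ
  X*-coeff-vanish (suc i) (s≤s b≤i) =
    trans (cong₂ (λ x y → ℕ→ℚ (suc i) * (x + y)) (coeff-vanish p i b≤i) (coeff-vanish p (suc i) (ℕP.m≤n⇒m≤1+n b≤i)))
          (ℚP.*-zeroʳ (ℕ→ℚ (suc i)))

polynomial-*binom : Polynomial φ → ∀ j → Polynomial (λ a → φ a * binom a j)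
polynomial-*binom {φ} p zero    = polynomial-cong (λ a → sym (ℚP.*-identityʳ (φ a))) p
polynomial-*binom {φ} p (suc j) = polynomial-cong next
  (polynomial-scale (ℤ.+ 1 / suc j) (polynomial-+ (polynomial-X* previous) (polynomial-scale (- ℕ→ℚ j) previous)))
  where
  previous = polynomial-*binom p j
  next : ∀ a → (ℤ.+ 1 / suc j) * (a * (φ a * binom a j) + (- ℕ→ℚ j) * (φ a * binom a j)) ≡ φ a * binom a (suc j)
  next a = solve 5 (λ r a f b i → r :* (a :* (f :* b) :+ (:- i) :* (f :* b)) := f :* (b :* (a :- i) :* r))
                   refl (ℤ.+ 1 / suc j) a (φ a) (binom a j) (ℕ→ℚ j)

polynomial-* : Polynomial φ → Polynomial ψ → Polynomial (λ a → φ a * ψ a)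
polynomial-* {φ} {ψ} p q = polynomial-cong expand
  (polynomial-∑-upTo (bound q) (λ j a → coeff q j * (φ a * binom a j)) (λ j → polynomial-scale (coeff q j) (polynomial-*binom p j)))
  where
  expand : ∀ a → ∑[ j ∈ upTo (bound q) ] coeff q j * (φ a * binom a j) ≡ φ a * ψ a
  expand a = sym (begin
    φ a * ψ a                                       ≡⟨ cong (φ a *_) (expansion q a) ⟩
    φ a * newton (coeff q) (bound q) a              ≡⟨ *-distribˡ-∑ (φ a) (upTo (bound q)) _ ⟩
    ∑[ j ∈ upTo (bound q) ] φ a * (coeff q j * binom a j)  ≡⟨ ∑-upTo-cong (bound q) (λ j _ → ℚ*.x∙yz≈y∙xz (φ a) (coeff q j) (binom a j)) ⟩
    ∑[ j ∈ upTo (bound q) ] coeff q j * (φ a * binom a j)  ∎)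

polynomial-vanish : Polynomial φ → (∀ n → φ (ℕ→ℚ n) ≡ 0ℚ) → ∀ a → φ a ≡ 0ℚ
polynomial-vanish p φ≡0 a = trans (expansion p a) (∑-upTo-zero (bound p) term≡0)
  where
  coeff≡0 : ∀ i → i < bound p → coeff p i ≡ 0ℚ
  coeff≡0 = newton-coeff-vanish (bound p) (coeff p) (λ n → trans (sym (expansion p (ℕ→ℚ n))) (φ≡0 n))
  term≡0 : ∀ i → i < bound p → coeff p i * binom a i ≡ 0ℚ
  term≡0 i i<b = trans (cong (_* binom a i) (coeff≡0 i i<b)) (ℚP.*-zeroˡ (binom a i))

polynomial-ext : Polynomial φ → Polynomial ψ → (∀ n → φ (ℕ→ℚ n) ≡ ψ (ℕ→ℚ n)) → φ ≗ ψ
polynomial-ext {φ} {ψ} p q agree a = begin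
  φ a                  ≡⟨ sym (ℚP.+-identityʳ (φ a)) ⟩
  φ a + 0ℚ             ≡⟨ cong (φ a +_) (sym (ℚP.+-inverseˡ (ψ a))) ⟩
  φ a + (- ψ a + ψ a)  ≡⟨ sym (ℚP.+-assoc (φ a) _ _) ⟩
  (φ a - ψ a) + ψ a    ≡⟨ cong (_+ ψ a) (polynomial-vanish difference agree′ a) ⟩
  0ℚ + ψ a             ≡⟨ ℚP.+-identityˡ (ψ a) ⟩
  ψ a                  ∎
  where
  difference : Polynomial (λ a → φ a - ψ a)
  difference = polynomial-cong (λ a → subtract (φ a) (ψ a)) (polynomial-+ p (polynomial-scale (- 1ℚ) q))
    where
    subtract : ∀ x y → x + (- 1ℚ) * y ≡ x - y
    subtract = solve 2 (λ x y → x :+ con (- 1ℚ) :* y := x :- y) refl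
  agree′ : ∀ n → φ (ℕ→ℚ n) - ψ (ℕ→ℚ n) ≡ 0ℚ
  agree′ n = trans (cong (_- ψ (ℕ→ℚ n)) (agree n)) (ℚP.+-inverseʳ (ψ (ℕ→ℚ n)))

_⊗_ : Series 1 → Series N → Series (suc N)
(f ⊗ g) (k ∷ m) = f (k ∷ []) * g m

oneS-⊗ : (oneS {suc N}) ≗ (oneS ⊗ oneS)
oneS-⊗ (zero  ∷ m) = sym (ℚP.*-identityˡ _)
oneS-⊗ (suc k ∷ m) = sym (ℚP.*-zeroˡ (oneS m))

oneS-∷ : (k : ℕ) (m : Mon N) → oneS (k ∷ m) ≡ ⟦ 0 ℕ.≡ᵇ k ⟧ * oneS m
oneS-∷ zero    m = sym (ℚP.*-identityˡ (oneS m))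
oneS-∷ (suc k) m = sym (ℚP.*-zeroˡ (oneS m))

∑-splits-∷ : (k : ℕ) (m : Mon N) (F : Split (suc N) → ℚ) →
  ∑ (splits (k ∷ m)) F ≡ ∑[ i ∈ upTo (suc k) ] ∑[ s ∈ splits m ] F (split (i ∷ Split.fst s) ((k ∸ i) ∷ Split.snd s))
∑-splits-∷ k m F = trans (∑-concatMap (λ i → List.map (extend i) (splits m)) (upTo (suc k)) F)
                         (∑-cong (upTo (suc k)) (λ i → ∑-map (extend i) (splits m) F))
  where
  extend : ℕ → Split _ → Split _
  extend i s = split (i ∷ Split.fst s) ((k ∸ i) ∷ Split.snd s)

∑-splits-1 : (k : ℕ) (F : Split 1 → ℚ) →
  ∑ (splits (k ∷ [])) F ≡ ∑[ i ∈ upTo (suc k) ] F (split (i ∷ []) ((k ∸ i) ∷ []))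
∑-splits-1 k F = trans (∑-splits-∷ k [] F) (∑-cong (upTo (suc k)) (λ i → ℚP.+-identityʳ (F (split (i ∷ []) ((k ∸ i) ∷ [])))))

splits-deg : (m : Mon N) → All (λ s → deg (Split.fst s) ℕ.+ deg (Split.snd s) ≡ deg m) (splits m)
splits-deg []      = refl ∷ []
splits-deg (k ∷ m) = AllP.concat⁺ (AllP.map⁺ (AllP.applyUpTo⁺₁ (λ i → i) (suc k) (λ {i} i<1+k →
  AllP.map⁺ (All.map (λ e → shuffle i (ℕP.≤-pred i<1+k) e) (splits-deg m)))))
  where
  shuffle : ∀ i → i ≤ k → ∀ {a b c} → a ℕ.+ b ≡ c → (i ℕ.+ a) ℕ.+ ((k ∸ i) ℕ.+ b) ≡ k ℕ.+ c
  shuffle i i≤k {a} {b} a+b≡c = trans (ℕ+.interchange i a (k ∸ i) b) (cong₂ ℕ._+_ (ℕP.m+[n∸m]≡n i≤k) a+b≡c)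

*S-cong : {f f′ g g′ : Series N} → f ≗ f′ → g ≗ g′ → (f *S g) ≗ (f′ *S g′)
*S-cong f≗f′ g≗g′ m = ∑-cong (splits m) (λ s → cong₂ _*_ (f≗f′ (Split.fst s)) (g≗g′ (Split.snd s)))

^S-cong : {f g : Series N} → f ≗ g → ∀ n → (f ^S n) ≗ (g ^S n)
^S-cong f≗g zero    = λ _ → refl
^S-cong f≗g (suc n) = *S-cong f≗g (^S-cong f≗g n)

*S-distribʳ-+S : (f g h : Series N) → ((f +S g) *S h) ≗ ((f *S h) +S (g *S h))
*S-distribʳ-+S f g h m = trans (∑-cong (splits m) (λ s → ℚP.*-distribʳ-+ (h (Split.snd s)) (f (Split.fst s)) (g (Split.fst s))))
                              (∑-distrib-+ (splits m) _ _)

*S-∑ : (f : Series N) (xs : List A) (c : A → ℚ) (g : A → Series N) (m : Mon N) →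
       (f *S (λ m′ → ∑[ x ∈ xs ] c x * g x m′)) m ≡ ∑[ x ∈ xs ] c x * (f *S g x) m
*S-∑ f xs c g m = begin
  ∑[ s ∈ splits m ] f (Split.fst s) * (∑[ x ∈ xs ] c x * g x (Split.snd s))
    ≡⟨ ∑-cong (splits m) (λ s → trans (*-distribˡ-∑ (f (Split.fst s)) xs _) (∑-cong xs (λ x → ℚ*.x∙yz≈y∙xz (f (Split.fst s)) (c x) _))) ⟩
  ∑[ s ∈ splits m ] ∑[ x ∈ xs ] c x * (f (Split.fst s) * g x (Split.snd s))
    ≡⟨ ∑-comm (splits m) xs _ ⟩
  ∑[ x ∈ xs ] ∑[ s ∈ splits m ] c x * (f (Split.fst s) * g x (Split.snd s))
    ≡⟨ ∑-cong xs (λ x → sym (*-distribˡ-∑ (c x) (splits m) _)) ⟩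
  ∑[ x ∈ xs ] c x * (f *S g x) m ∎

⊗-*S : (f f′ : Series 1) (g g′ : Series N) → ((f ⊗ g) *S (f′ ⊗ g′)) ≗ ((f *S f′) ⊗ (g *S g′))
⊗-*S f f′ g g′ (k ∷ m) = begin
  ((f ⊗ g) *S (f′ ⊗ g′)) (k ∷ m)
    ≡⟨ ∑-splits-∷ k m _ ⟩
  ∑[ i ∈ upTo (suc k) ] ∑[ s ∈ splits m ] (f (i ∷ []) * g (Split.fst s)) * (f′ ((k ∸ i) ∷ []) * g′ (Split.snd s))
    ≡⟨ ∑-cong (upTo (suc k)) factor ⟩
  ∑[ i ∈ upTo (suc k) ] first i * (g *S g′) m
    ≡⟨ sym (*-distribʳ-∑ ((g *S g′) m) (upTo (suc k)) first) ⟩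
  (∑ (upTo (suc k)) first) * (g *S g′) m
    ≡⟨ cong (_* (g *S g′) m) (sym (∑-splits-1 k (λ s → f (Split.fst s) * f′ (Split.snd s)))) ⟩
  ((f *S f′) ⊗ (g *S g′)) (k ∷ m) ∎
  where
  first : ℕ → ℚ
  first i = f (i ∷ []) * f′ ((k ∸ i) ∷ [])
  factor : ∀ i → ∑[ s ∈ splits m ] (f (i ∷ []) * g (Split.fst s)) * (f′ ((k ∸ i) ∷ []) * g′ (Split.snd s))
                 ≡ first i * (g *S g′) m
  factor i = trans (∑-cong (splits m) (λ s → ℚ*.interchange (f (i ∷ [])) (g (Split.fst s)) (f′ ((k ∸ i) ∷ [])) (g′ (Split.snd s))))
                   (sym (*-distribˡ-∑ (first i) (splits m) (λ s → g (Split.fst s) * g′ (Split.snd s))))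

⊗-^S : (f : Series 1) (g : Series N) → ∀ n → ((f ⊗ g) ^S n) ≗ ((f ^S n) ⊗ (g ^S n))
⊗-^S f g zero    = oneS-⊗
⊗-^S f g (suc n) m = trans (*S-cong {f = f ⊗ g} (λ _ → refl) (⊗-^S f g n) m) (⊗-*S f (f ^S n) g (g ^S n) m)

*S-identityˡ : (h : Series N) → (oneS *S h) ≗ h
*S-identityˡ h []      = trans (ℚP.+-identityʳ _) (ℚP.*-identityˡ _)
*S-identityˡ h (k ∷ m) = begin
  (oneS *S h) (k ∷ m)                                    ≡⟨ ∑-splits-∷ k m _ ⟩
  ∑[ i ∈ upTo (suc k) ] term i                           ≡⟨ ∑-upTo-suc k term ⟩
  (oneS *S (λ m′ → h (k ∷ m′))) m + ∑ (upTo k) (term ∘ suc)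
    ≡⟨ cong₂ _+_ (*S-identityˡ (λ m′ → h (k ∷ m′)) m) (∑-upTo-zero k (λ i _ → term-suc≡0 i)) ⟩
  h (k ∷ m) + 0ℚ                                         ≡⟨ ℚP.+-identityʳ _ ⟩
  h (k ∷ m)                                              ∎
  where
  term : ℕ → ℚ
  term i = ∑[ s ∈ splits m ] oneS (i ∷ Split.fst s) * h ((k ∸ i) ∷ Split.snd s)
  term-suc≡0 : ∀ i → term (suc i) ≡ 0ℚ
  term-suc≡0 i = ∑-zero (All.universal (λ s → ℚP.*-zeroˡ (h ((k ∸ suc i) ∷ Split.snd s))) (splits m))

*S-identityʳ : (h : Series 1) → (h *S oneS) ≗ h
*S-identityʳ h (d ∷ []) = begin
  (h *S oneS) (d ∷ [])                                 ≡⟨ ∑-splits-1 d (λ s → h (Split.fst s) * oneS (Split.snd s)) ⟩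
  ∑[ i ∈ upTo (suc d) ] h (i ∷ []) * oneS ((d ∸ i) ∷ []) ≡⟨ ∑-upTo-snoc d _ ⟩
  ∑ (upTo d) (λ i → h (i ∷ []) * oneS ((d ∸ i) ∷ [])) + h (d ∷ []) * oneS ((d ∸ d) ∷ [])
    ≡⟨ cong₂ _+_ (∑-upTo-zero d below-d) at-d ⟩
  0ℚ + h (d ∷ [])                                      ≡⟨ ℚP.+-identityˡ _ ⟩
  h (d ∷ [])                                           ∎
  where
  at-d : h (d ∷ []) * oneS ((d ∸ d) ∷ []) ≡ h (d ∷ [])
  at-d = trans (cong (λ j → h (d ∷ []) * oneS (j ∷ [])) (ℕP.n∸n≡0 d)) (ℚP.*-identityʳ (h (d ∷ [])))
  below-d : ∀ i → i < d → h (i ∷ []) * oneS ((d ∸ i) ∷ []) ≡ 0ℚ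
  below-d i i<d = trans (cong (λ j → h (i ∷ []) * oneS (j ∷ [])) (ℕP.+-∸-assoc 1 i<d)) (ℚP.*-zeroʳ (h (i ∷ [])))

VanishesBelow : ℕ → Series N → Set
VanishesBelow r f = ∀ m → deg m < r → f m ≡ 0ℚ

vanishesBelow-≤ : ∀ {r s} {f : Series N} → r ≤ s → VanishesBelow s f → VanishesBelow r f
vanishesBelow-≤ r≤s f≡0 m deg<r = f≡0 m (ℕP.<-≤-trans deg<r r≤s)

vanishesBelow-*S : ∀ {r s} {f g : Series N} → VanishesBelow r f → VanishesBelow s g → VanishesBelow (r ℕ.+ s) (f *S g)
vanishesBelow-*S {r = r} {s} {f} {g} f≡0 g≡0 m deg<r+s = ∑-zero (All.map term≡0 (splits-deg m))
  where
  term≡0 : ∀ {sp} → deg (Split.fst sp) ℕ.+ deg (Split.snd sp) ≡ deg m → f (Split.fst sp) * g (Split.snd sp) ≡ 0ℚ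
  term≡0 {sp} degs with deg (Split.fst sp) ℕ.<? r
  ... | yes fst<r = trans (cong (_* g (Split.snd sp)) (f≡0 (Split.fst sp) fst<r)) (ℚP.*-zeroˡ (g (Split.snd sp)))
  ... | no  fst≮r = trans (cong (f (Split.fst sp) *_) (g≡0 (Split.snd sp) snd<s)) (ℚP.*-zeroʳ (f (Split.fst sp)))
    where
    snd<s : deg (Split.snd sp) < s
    snd<s = ℕP.+-cancelˡ-< r _ s (ℕP.≤-<-trans (ℕP.+-monoˡ-≤ _ (ℕP.≮⇒≥ fst≮r)) (subst (_< r ℕ.+ s) (sym degs) deg<r+s))

vanishesBelow-*Sˡ : ∀ {r} {f g : Series N} → VanishesBelow r f → VanishesBelow r (f *S g)
vanishesBelow-*Sˡ {r = r} f≡0 m deg<r = vanishesBelow-*S {s = 0} f≡0 (λ _ ()) m (subst (deg m <_) (sym (ℕP.+-identityʳ r)) deg<r)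

vanishesBelow-^S : {u : Series N} → VanishesBelow 1 u → ∀ i → VanishesBelow i (u ^S i)
vanishesBelow-^S u≡0 zero    m ()
vanishesBelow-^S u≡0 (suc i) = vanishesBelow-*S u≡0 (vanishesBelow-^S u≡0 i)

binom-pascal-∑ : (n : ℕ) (v : ℕ → ℚ) →
  (∑[ i ∈ upTo (suc n) ] binom (ℕ→ℚ n) i * v i) + (∑[ i ∈ upTo (suc n) ] binom (ℕ→ℚ n) i * v (suc i))
  ≡ ∑[ i ∈ upTo (suc (suc n)) ] binom (ℕ→ℚ (suc n)) i * v i
binom-pascal-∑ n v = begin
  ∑ (upTo (suc n)) (λ i → c i * v i) + shifted
    ≡⟨ cong (_+ shifted) (∑-upTo-suc n (λ i → c i * v i)) ⟩
  (v₀ + ∑ (upTo n) (λ i → c (suc i) * v (suc i))) + shifted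
    ≡⟨ cong (λ x → (v₀ + x) + shifted) (sym (∑-upTo-extend n (suc n) _ (ℕP.n≤1+n n) top≡0)) ⟩
  (v₀ + ∑ (upTo (suc n)) (λ i → c (suc i) * v (suc i))) + shifted
    ≡⟨ ℚP.+-assoc v₀ _ shifted ⟩
  v₀ + (∑ (upTo (suc n)) (λ i → c (suc i) * v (suc i)) + shifted)
    ≡⟨ cong (v₀ +_) (sym (∑-distrib-+ (upTo (suc n)) (λ i → c (suc i) * v (suc i)) (λ i → c i * v (suc i)))) ⟩
  v₀ + (∑[ i ∈ upTo (suc n) ] (c (suc i) * v (suc i) + c i * v (suc i)))
    ≡⟨ cong (v₀ +_) (∑-upTo-cong (suc n) (λ i _ → pascal-term i)) ⟩
  v₀ + (∑[ i ∈ upTo (suc n) ] binom (ℕ→ℚ (suc n)) (suc i) * v (suc i))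
    ≡⟨ sym (∑-upTo-suc (suc n) (λ i → binom (ℕ→ℚ (suc n)) i * v i)) ⟩
  ∑[ i ∈ upTo (suc (suc n)) ] binom (ℕ→ℚ (suc n)) i * v i ∎
  where
  c : ℕ → ℚ
  c = binom (ℕ→ℚ n)
  v₀ = c 0 * v 0
  shifted = ∑[ i ∈ upTo (suc n) ] c i * v (suc i)
  top≡0 : ∀ i → n ≤ i → i < suc n → c (suc i) * v (suc i) ≡ 0ℚ
  top≡0 i n≤i _ = trans (cong (_* v (suc i)) (binom-ℕ-vanish n (suc i) (s≤s n≤i))) (ℚP.*-zeroˡ (v (suc i)))
  pascal-term : ∀ i → c (suc i) * v (suc i) + c i * v (suc i) ≡ binom (ℕ→ℚ (suc n)) (suc i) * v (suc i)
  pascal-term i = trans (sym (ℚP.*-distribʳ-+ (v (suc i)) (c (suc i)) (c i)))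
                        (cong (_* v (suc i)) (sym (trans (cong (λ x → binom x (suc i)) (ℕ→ℚ-suc n)) (binom-pascal (ℕ→ℚ n) i))))

binomial-theorem : (u : Series N) (n : ℕ) (m : Mon N) →
  ((oneS +S u) ^S n) m ≡ ∑[ i ∈ upTo (suc n) ] binom (ℕ→ℚ n) i * (u ^S i) m
binomial-theorem u zero    m = sym (trans (ℚP.+-identityʳ _) (ℚP.*-identityˡ (oneS m)))
binomial-theorem u (suc n) m = begin
  ((oneS +S u) *S P) m
    ≡⟨ *S-distribʳ-+S oneS u P m ⟩
  (oneS *S P) m + (u *S P) m
    ≡⟨ cong₂ _+_ (*S-identityˡ P m) (*S-cong {f = u} (λ _ → refl) (binomial-theorem u n) m) ⟩
  P m + (u *S (λ m′ → ∑[ i ∈ upTo (suc n) ] c i * (u ^S i) m′)) m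
    ≡⟨ cong₂ _+_ (binomial-theorem u n m) (*S-∑ u (upTo (suc n)) c (u ^S_) m) ⟩
  (∑[ i ∈ upTo (suc n) ] c i * v i) + (∑[ i ∈ upTo (suc n) ] c i * v (suc i))
    ≡⟨ binom-pascal-∑ n v ⟩
  ∑[ i ∈ upTo (suc (suc n)) ] binom (ℕ→ℚ (suc n)) i * v i ∎
  where
  P = (oneS +S u) ^S n
  c : ℕ → ℚ
  c = binom (ℕ→ℚ n)
  v : ℕ → ℚ
  v i = (u ^S i) m

onePlusPow-ℕ : {u : Series N} → VanishesBelow 1 u → ∀ n → onePlusPow u (ℕ→ℚ n) ≗ ((oneS +S u) ^S n)
onePlusPow-ℕ {u = u} u≡0 n m = begin
  ∑ (upTo (suc (deg m))) g  ≡⟨ sym (∑-upTo-extend (suc (deg m)) L g (ℕP.m≤m+n _ _) high-powers≡0) ⟩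
  ∑ (upTo L) g              ≡⟨ ∑-upTo-extend (suc n) L g (ℕP.m≤n+m (suc n) (suc (deg m))) high-binoms≡0 ⟩
  ∑ (upTo (suc n)) g        ≡⟨ sym (binomial-theorem u n m) ⟩
  ((oneS +S u) ^S n) m      ∎
  where
  g : ℕ → ℚ
  g i = binom (ℕ→ℚ n) i * (u ^S i) m
  L = suc (deg m) ℕ.+ suc n
  high-powers≡0 : ∀ i → suc (deg m) ≤ i → i < L → g i ≡ 0ℚ
  high-powers≡0 i deg<i _ = trans (cong (binom (ℕ→ℚ n) i *_) (vanishesBelow-^S u≡0 i m deg<i)) (ℚP.*-zeroʳ (binom (ℕ→ℚ n) i))
  high-binoms≡0 : ∀ i → suc n ≤ i → i < L → g i ≡ 0ℚ
  high-binoms≡0 i n<i _ = trans (cong (_* (u ^S i) m) (binom-ℕ-vanish n i n<i)) (ℚP.*-zeroˡ ((u ^S i) m))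

onePlusPow-polynomial : (u : Series N) (m : Mon N) → Polynomial (λ a → onePlusPow u a m)
onePlusPow-polynomial u m = polynomial-cong
  (λ a → ∑-upTo-cong (suc (deg m)) (λ i _ → ℚP.*-comm ((u ^S i) m) (binom a i)))
  (polynomial-∑-upTo (suc (deg m)) (λ i a → (u ^S i) m * binom a i) (λ i → polynomial-scale ((u ^S i) m) (polynomial-binom i)))

module _ {U : Series (suc N)} {x : Series 1} {y : Series N}
         (U≗x⊗y : (oneS +S U) ≗ ((oneS +S x) ⊗ (oneS +S y)))
         (U≡0 : VanishesBelow 1 U) (x≡0 : VanishesBelow 1 x) (y≡0 : VanishesBelow 1 y) where

  onePlusPow-⊗-ℕ : ∀ n → onePlusPow U (ℕ→ℚ n) ≗ (onePlusPow x (ℕ→ℚ n) ⊗ onePlusPow y (ℕ→ℚ n))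
  onePlusPow-⊗-ℕ n (k ∷ m) = begin
    onePlusPow U (ℕ→ℚ n) (k ∷ m)                           ≡⟨ onePlusPow-ℕ U≡0 n (k ∷ m) ⟩
    ((oneS +S U) ^S n) (k ∷ m)                             ≡⟨ ^S-cong U≗x⊗y n (k ∷ m) ⟩
    (((oneS +S x) ⊗ (oneS +S y)) ^S n) (k ∷ m)             ≡⟨ ⊗-^S (oneS +S x) (oneS +S y) n (k ∷ m) ⟩
    ((oneS +S x) ^S n) (k ∷ []) * ((oneS +S y) ^S n) m      ≡⟨ sym (cong₂ _*_ (onePlusPow-ℕ x≡0 n (k ∷ [])) (onePlusPow-ℕ y≡0 n m)) ⟩
    onePlusPow x (ℕ→ℚ n) (k ∷ []) * onePlusPow y (ℕ→ℚ n) m  ∎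

  onePlusPow-⊗ : ∀ a → onePlusPow U a ≗ (onePlusPow x a ⊗ onePlusPow y a)
  onePlusPow-⊗ a (k ∷ m) =
    polynomial-ext (onePlusPow-polynomial U (k ∷ m))
                   (polynomial-* (onePlusPow-polynomial x (k ∷ [])) (onePlusPow-polynomial y m))
                   (λ n → onePlusPow-⊗-ℕ n (k ∷ m)) a

tPow-suc : (j d : ℕ) → tPow (suc j) (d ∷ []) ≡ ⟦ suc j ℕ.+ 0 ℕ.≡ᵇ d ⟧
tPow-suc j d = trans (if-1-0≡⟦⟧ (d ℕ.≡ᵇ suc j)) (cong ⟦_⟧ (trans (≡ᵇ-comm d (suc j)) (cong (ℕ._≡ᵇ d) (sym (ℕP.+-identityʳ (suc j))))))

tPow-vanishesBelow : (k : ℕ) → VanishesBelow k (tPow k)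
tPow-vanishesBelow k (d ∷ []) d+0<k =
  trans (if-1-0≡⟦⟧ (d ℕ.≡ᵇ k)) (⟦≡ᵇ⟧-≢ d k (ℕP.<⇒≢ (subst (_< k) (ℕP.+-identityʳ d) d+0<k)))

powerMon : ℕ → Subset N → Mon N
powerMon j c = monOf (weight1 (suc j) (s≤s z≤n)) (c ∷ [])

-- the expansion of ∏_i (1 + x_i^(j+1))
subsetMonomials : (N j : ℕ) → Series N
subsetMonomials N j m = ∑[ c ∈ allSubsets N ] ⟦ monEqB (powerMon j c) m ⟧

pbar-as-∑ : (N j : ℕ) (m : Mon N) → pbar N (suc j) m ≡ ∑[ c ∈ allSubsets N ] ⟦ nonEmptyB c ∧ monEqB (powerMon j c) m ⟧
pbar-as-∑ N j m = trans (count≡∑⟦⟧ _ (allVecs (allSubsets N) 1)) (trans (∑-concatMap _ (allSubsets N) _)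
  (∑-cong (allSubsets N) (λ c → trans (ℚP.+-identityʳ _) (cong ⟦_⟧ (drop-trues (nonEmptyB c) (monEqB (powerMon j c) m))))))
  where
  drop-trues : ∀ a b → ((a ∧ true) ∧ true) ∧ b ≡ a ∧ b
  drop-trues true  b = refl
  drop-trues false b = refl

pbar-∷ : (N j k : ℕ) (m : Mon N) →
  pbar (suc N) (suc j) (k ∷ m) ≡ ⟦ suc j ℕ.+ 0 ℕ.≡ᵇ k ⟧ * subsetMonomials N j m + ⟦ 0 ℕ.≡ᵇ k ⟧ * pbar N (suc j) m
pbar-∷ N j k m = begin
  pbar (suc N) (suc j) (k ∷ m)
    ≡⟨ pbar-as-∑ (suc N) j (k ∷ m) ⟩
  ∑[ c ∈ allSubsets (suc N) ] ⟦ nonEmptyB c ∧ monEqB (powerMon j c) (k ∷ m) ⟧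
    ≡⟨ ∑-allSubsets-suc (λ c → ⟦ nonEmptyB c ∧ monEqB (powerMon j c) (k ∷ m) ⟧) ⟩
  (∑[ c ∈ Cs ] ⟦ nonEmptyB (true ∷ c) ∧ (hit ∧ E c) ⟧) + (∑[ c ∈ Cs ] ⟦ nonEmptyB (false ∷ c) ∧ (miss ∧ E c) ⟧)
    ≡⟨ cong₂ _+_ (∑-cong Cs with-first) (∑-cong Cs without-first) ⟩
  (∑[ c ∈ Cs ] ⟦ hit ⟧ * ⟦ E c ⟧) + (∑[ c ∈ Cs ] ⟦ miss ⟧ * ⟦ nonEmptyB c ∧ E c ⟧)
    ≡⟨ sym (cong₂ _+_ (*-distribˡ-∑ ⟦ hit ⟧ Cs (λ c → ⟦ E c ⟧))
                      (trans (cong (⟦ miss ⟧ *_) (pbar-as-∑ N j m)) (*-distribˡ-∑ ⟦ miss ⟧ Cs (λ c → ⟦ nonEmptyB c ∧ E c ⟧)))) ⟩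
  ⟦ hit ⟧ * subsetMonomials N j m + ⟦ miss ⟧ * pbar N (suc j) m ∎
  where
  Cs   = allSubsets N
  hit  = suc j ℕ.+ 0 ℕ.≡ᵇ k
  miss = 0 ℕ.≡ᵇ k
  E : Subset N → Bool
  E c = monEqB (powerMon j c) m
  with-first : ∀ c → ⟦ nonEmptyB (true ∷ c) ∧ (hit ∧ E c) ⟧ ≡ ⟦ hit ⟧ * ⟦ E c ⟧
  with-first c = trans (cong (λ b → ⟦ b ∧ (hit ∧ E c) ⟧) (nonEmptyB-∷ true c)) (⟦∧⟧ hit (E c))
  pull-out : ∀ a x e → ⟦ a ∧ (x ∧ e) ⟧ ≡ ⟦ x ⟧ * ⟦ a ∧ e ⟧
  pull-out a     true  e = sym (ℚP.*-identityˡ _)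
  pull-out true  false e = sym (ℚP.*-zeroˡ ⟦ e ⟧)
  pull-out false false e = refl
  without-first : ∀ c → ⟦ nonEmptyB (false ∷ c) ∧ (miss ∧ E c) ⟧ ≡ ⟦ miss ⟧ * ⟦ nonEmptyB c ∧ E c ⟧
  without-first c = trans (cong (λ b → ⟦ b ∧ (miss ∧ E c) ⟧) (nonEmptyB-∷ false c)) (pull-out (nonEmptyB c) miss (E c))

subsetMonomials-⊗ : (N j : ℕ) → subsetMonomials (suc N) j ≗ ((oneS +S tPow (suc j)) ⊗ subsetMonomials N j)
subsetMonomials-⊗ N j (k ∷ m) = begin
  subsetMonomials (suc N) j (k ∷ m)
    ≡⟨ ∑-allSubsets-suc (λ c → ⟦ monEqB (powerMon j c) (k ∷ m) ⟧) ⟩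
  (∑[ c ∈ Cs ] ⟦ hit ∧ E c ⟧) + (∑[ c ∈ Cs ] ⟦ miss ∧ E c ⟧)
    ≡⟨ cong₂ _+_ (pull-out hit) (pull-out miss) ⟩
  ⟦ hit ⟧ * Q + ⟦ miss ⟧ * Q
    ≡⟨ trans (ℚP.+-comm (⟦ hit ⟧ * Q) _) (sym (ℚP.*-distribʳ-+ Q ⟦ miss ⟧ ⟦ hit ⟧)) ⟩
  (⟦ miss ⟧ + ⟦ hit ⟧) * Q
    ≡⟨ cong₂ (λ x y → (x + y) * Q) (sym (trans (oneS-∷ k []) (ℚP.*-identityʳ ⟦ miss ⟧))) (sym (tPow-suc j k)) ⟩
  (oneS (k ∷ []) + tPow (suc j) (k ∷ [])) * Q ∎
  where
  Cs   = allSubsets N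
  hit  = suc j ℕ.+ 0 ℕ.≡ᵇ k
  miss = 0 ℕ.≡ᵇ k
  Q    = subsetMonomials N j m
  E : Subset N → Bool
  E c = monEqB (powerMon j c) m
  pull-out : ∀ b → ∑[ c ∈ Cs ] ⟦ b ∧ E c ⟧ ≡ ⟦ b ⟧ * Q
  pull-out b = trans (∑-cong Cs (λ c → ⟦∧⟧ b (E c))) (sym (*-distribˡ-∑ ⟦ b ⟧ Cs (λ c → ⟦ E c ⟧)))

subsetMonomials≗1+pbar : (N j : ℕ) → subsetMonomials N j ≗ (oneS +S pbar N (suc j))
subsetMonomials≗1+pbar zero    j []      = refl
subsetMonomials≗1+pbar (suc N) j (k ∷ m) = begin
  subsetMonomials (suc N) j (k ∷ m)
    ≡⟨ subsetMonomials-⊗ N j (k ∷ m) ⟩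
  (oneS (k ∷ []) + tPow (suc j) (k ∷ [])) * subsetMonomials N j m
    ≡⟨ cong₂ (λ x y → (x + y) * subsetMonomials N j m) (trans (oneS-∷ k []) (ℚP.*-identityʳ ⟦ miss ⟧)) (tPow-suc j k) ⟩
  (⟦ miss ⟧ + ⟦ hit ⟧) * subsetMonomials N j m
    ≡⟨ cong ((⟦ miss ⟧ + ⟦ hit ⟧) *_) (subsetMonomials≗1+pbar N j m) ⟩
  (⟦ miss ⟧ + ⟦ hit ⟧) * (oneS m + P)
    ≡⟨ regroup ⟦ miss ⟧ ⟦ hit ⟧ (oneS m) P ⟩
  ⟦ miss ⟧ * oneS m + (⟦ hit ⟧ * (oneS m + P) + ⟦ miss ⟧ * P)
    ≡⟨ cong₂ (λ x q → x + (⟦ hit ⟧ * q + ⟦ miss ⟧ * P)) (sym (oneS-∷ k m)) (sym (subsetMonomials≗1+pbar N j m)) ⟩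
  oneS (k ∷ m) + (⟦ hit ⟧ * subsetMonomials N j m + ⟦ miss ⟧ * P)
    ≡⟨ cong (oneS (k ∷ m) +_) (sym (pbar-∷ N j k m)) ⟩
  oneS (k ∷ m) + pbar (suc N) (suc j) (k ∷ m) ∎
  where
  hit  = suc j ℕ.+ 0 ℕ.≡ᵇ k
  miss = 0 ℕ.≡ᵇ k
  P    = pbar N (suc j) m
  regroup : ∀ z h o p → (z + h) * (o + p) ≡ z * o + (h * (o + p) + z * p)
  regroup = solve 4 (λ z h o p → (z :+ h) :* (o :+ p) := z :* o :+ (h :* (o :+ p) :+ z :* p)) refl

1+pbar-⊗ : (N j : ℕ) → (oneS +S pbar (suc N) (suc j)) ≗ ((oneS +S tPow (suc j)) ⊗ (oneS +S pbar N (suc j)))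
1+pbar-⊗ N j (k ∷ m) = begin
  oneS (k ∷ m) + pbar (suc N) (suc j) (k ∷ m)                       ≡⟨ sym (subsetMonomials≗1+pbar (suc N) j (k ∷ m)) ⟩
  subsetMonomials (suc N) j (k ∷ m)                                 ≡⟨ subsetMonomials-⊗ N j (k ∷ m) ⟩
  (oneS +S tPow (suc j)) (k ∷ []) * subsetMonomials N j m           ≡⟨ cong ((oneS +S tPow (suc j)) (k ∷ []) *_) (subsetMonomials≗1+pbar N j m) ⟩
  (oneS +S tPow (suc j)) (k ∷ []) * (oneS m + pbar N (suc j) m)     ∎

pbar-vanishesBelow-1 : (N j : ℕ) → VanishesBelow 1 (pbar N (suc j))
pbar-vanishesBelow-1 zero    j []           _     = refl
pbar-vanishesBelow-1 (suc N) j (suc k ∷ m) (s≤s ())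
pbar-vanishesBelow-1 (suc N) j (zero ∷ m)  deg<1 = begin
  pbar (suc N) (suc j) (zero ∷ m)                         ≡⟨ pbar-∷ N j zero m ⟩
  0ℚ * subsetMonomials N j m + 1ℚ * pbar N (suc j) m
    ≡⟨ cong₂ _+_ (ℚP.*-zeroˡ (subsetMonomials N j m)) (ℚP.*-identityˡ (pbar N (suc j) m)) ⟩
  0ℚ + pbar N (suc j) m                                   ≡⟨ ℚP.+-identityˡ _ ⟩
  pbar N (suc j) m                                        ≡⟨ pbar-vanishesBelow-1 N j m deg<1 ⟩
  0ℚ                                                      ∎

-- Factorisation of ∏_k (1 + p̄_k)^(a(k))

-- tensorPower F N = F(x_1) ⋯ F(x_N)
tensorPower : Series 1 → (N : ℕ) → Series N
tensorPower F zero    = oneS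
tensorPower F (suc N) = F ⊗ tensorPower F N

tensorPower-cong : {F G : Series 1} → F ≗ G → ∀ N → tensorPower F N ≗ tensorPower G N
tensorPower-cong F≗G zero    m       = refl
tensorPower-cong F≗G (suc N) (k ∷ m) = cong₂ _*_ (F≗G (k ∷ [])) (tensorPower-cong F≗G N m)

module _ (a : ℕ → ℚ) where

  pbarFactor-⊗ : ∀ N i → pbarFactor (suc N) a i ≗ (tFactor a i ⊗ pbarFactor N a i)
  pbarFactor-⊗ N zero    = oneS-⊗
  pbarFactor-⊗ N (suc j) = onePlusPow-⊗ (1+pbar-⊗ N j) (pbar-vanishesBelow-1 (suc N) j)
    (vanishesBelow-≤ (s≤s z≤n) (tPow-vanishesBelow (suc j))) (pbar-vanishesBelow-1 N j) (a (suc j))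

  prodUpTo-pbarFactor-⊗ : ∀ N K → prodUpTo (pbarFactor (suc N) a) K ≗ (prodUpTo (tFactor a) K ⊗ prodUpTo (pbarFactor N a) K)
  prodUpTo-pbarFactor-⊗ N zero      = oneS-⊗
  prodUpTo-pbarFactor-⊗ N (suc K) m =
    trans (*S-cong (prodUpTo-pbarFactor-⊗ N K) (pbarFactor-⊗ N (suc K)) m)
          (⊗-*S (prodUpTo (tFactor a) K) (tFactor a (suc K)) (prodUpTo (pbarFactor N a) K) (pbarFactor N a (suc K)) m)

  tFactor-≡1-below : ∀ j e → e < suc j → tFactor a (suc j) (e ∷ []) ≡ oneS (e ∷ [])
  tFactor-≡1-below j e e<1+j = begin
    ∑[ i ∈ upTo (suc (e ℕ.+ 0)) ] binom (a (suc j)) i * (t ^S i) (e ∷ [])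
      ≡⟨ ∑-upTo-suc (e ℕ.+ 0) (λ i → binom (a (suc j)) i * (t ^S i) (e ∷ [])) ⟩
    1ℚ * oneS (e ∷ []) + (∑[ i ∈ upTo (e ℕ.+ 0) ] binom (a (suc j)) (suc i) * (t ^S suc i) (e ∷ []))
      ≡⟨ cong (1ℚ * oneS (e ∷ []) +_) (∑-upTo-zero (e ℕ.+ 0) (λ i _ → positive-power≡0 i)) ⟩
    1ℚ * oneS (e ∷ []) + 0ℚ
      ≡⟨ trans (ℚP.+-identityʳ _) (ℚP.*-identityˡ _) ⟩
    oneS (e ∷ []) ∎
    where
    t = tPow (suc j)
    positive-power≡0 : ∀ i → binom (a (suc j)) (suc i) * (t ^S suc i) (e ∷ []) ≡ 0ℚ
    positive-power≡0 i = trans (cong (binom (a (suc j)) (suc i) *_) t^1+i≡0) (ℚP.*-zeroʳ (binom (a (suc j)) (suc i)))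
      where
      t^1+i≡0 : (t ^S suc i) (e ∷ []) ≡ 0ℚ
      t^1+i≡0 = vanishesBelow-*Sˡ {g = t ^S i} (tPow-vanishesBelow (suc j)) (e ∷ []) (subst (_< suc j) (sym (ℕP.+-identityʳ e)) e<1+j)

  *S-≡1-below : (h f : Series 1) (d : ℕ) → (∀ e → e ≤ d → f (e ∷ []) ≡ oneS (e ∷ [])) → (h *S f) (d ∷ []) ≡ h (d ∷ [])
  *S-≡1-below h f d f≡1 = begin
    (h *S f) (d ∷ [])                                       ≡⟨ ∑-splits-1 d (λ s → h (Split.fst s) * f (Split.snd s)) ⟩
    ∑[ i ∈ upTo (suc d) ] h (i ∷ []) * f ((d ∸ i) ∷ [])     ≡⟨ ∑-upTo-cong (suc d) (λ i _ → cong (h (i ∷ []) *_) (f≡1 (d ∸ i) (ℕP.m∸n≤m d i))) ⟩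
    ∑[ i ∈ upTo (suc d) ] h (i ∷ []) * oneS ((d ∸ i) ∷ [])  ≡⟨ sym (∑-splits-1 d (λ s → h (Split.fst s) * oneS (Split.snd s))) ⟩
    (h *S oneS) (d ∷ [])                                    ≡⟨ *S-identityʳ h (d ∷ []) ⟩
    h (d ∷ [])                                              ∎

  prodUpTo-tFactor-stable : ∀ d K → d ≤ K → prodUpTo (tFactor a) K (d ∷ []) ≡ prodUpTo (tFactor a) d (d ∷ [])
  prodUpTo-tFactor-stable d zero    z≤n   = refl
  prodUpTo-tFactor-stable d (suc K) d≤1+K with ℕP.m≤n⇒m<n∨m≡n d≤1+K
  ... | inj₂ refl       = refl
  ... | inj₁ (s≤s d≤K) = trans
    (*S-≡1-below (prodUpTo (tFactor a) K) (tFactor a (suc K)) d (λ e e≤d → tFactor-≡1-below K e (s≤s (ℕP.≤-trans e≤d d≤K))))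
    (prodUpTo-tFactor-stable d K d≤K)

  prodUpTo-tFactor≡infProd : ∀ d K → d ≤ K → prodUpTo (tFactor a) K (d ∷ []) ≡ infProd (tFactor a) (d ∷ [])
  prodUpTo-tFactor≡infProd d K d≤K =
    trans (prodUpTo-tFactor-stable d K d≤K) (sym (prodUpTo-tFactor-stable d (d ℕ.+ 0) (ℕP.m≤m+n d 0)))

  prodUpTo-pbarFactor : ∀ N K (m : Mon N) → deg m ≤ K → prodUpTo (pbarFactor N a) K m ≡ tensorPower (infProd (tFactor a)) N m
  prodUpTo-pbarFactor zero    zero    []      _     = refl
  -- in no variables every factor evaluates to the constant 1
  prodUpTo-pbarFactor zero    (suc K) []      _     = cong (λ x → x * 1ℚ + 0ℚ) (prodUpTo-pbarFactor zero K [] z≤n)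
  prodUpTo-pbarFactor (suc N) K       (k ∷ m) deg≤K = begin
    prodUpTo (pbarFactor (suc N) a) K (k ∷ m)                         ≡⟨ prodUpTo-pbarFactor-⊗ N K (k ∷ m) ⟩
    prodUpTo (tFactor a) K (k ∷ []) * prodUpTo (pbarFactor N a) K m  ≡⟨ cong₂ _*_ (prodUpTo-tFactor≡infProd k K (ℕP.m+n≤o⇒m≤o k deg≤K))
                                                                                  (prodUpTo-pbarFactor N K m (ℕP.m+n≤o⇒n≤o k deg≤K)) ⟩
    infProd (tFactor a) (k ∷ []) * tensorPower (infProd (tFactor a)) N m ∎

  infProd-pbarFactor : ∀ N → infProd (pbarFactor N a) ≗ tensorPower (infProd (tFactor a)) N
  infProd-pbarFactor N m = prodUpTo-pbarFactor N (deg m) m ℕP.≤-refl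

-- When b fails, the subsets W containing the first vertex cancel those that do not.
inclusion-exclusion-step : {n : ℕ} (R : Subset n → Bool) (b : Bool) →
  ⟦ b ⟧ * (∑[ W ∈ allSubsets n ] sign ∣ ∁ W ∣ * ⟦ R W ⟧)
  ≡ ∑[ W ∈ allSubsets (suc n) ] sign ∣ ∁ W ∣ * ⟦ (not b ∨ Vec.head W) ∧ R (Vec.tail W) ⟧
inclusion-exclusion-step {n} R b =
  trans (by-first-vertex b) (sym (∑-allSubsets-suc (λ W → sign ∣ ∁ W ∣ * ⟦ (not b ∨ Vec.head W) ∧ R (Vec.tail W) ⟧)))
  where
  X = ∑[ W ∈ allSubsets n ] sign ∣ ∁ W ∣ * ⟦ R W ⟧
  by-first-vertex : ∀ b → ⟦ b ⟧ * X ≡ (∑[ W ∈ allSubsets n ] sign ∣ ∁ (true ∷ W) ∣ * ⟦ (not b ∨ true) ∧ R W ⟧)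
                                        + (∑[ W ∈ allSubsets n ] sign ∣ ∁ (false ∷ W) ∣ * ⟦ (not b ∨ false) ∧ R W ⟧)
  by-first-vertex true = begin
    1ℚ * X  ≡⟨ ℚP.*-identityˡ X ⟩
    X       ≡⟨ sym (ℚP.+-identityʳ X) ⟩
    X + 0ℚ  ≡⟨ cong (X +_) (sym (∑-zero (All.universal (λ W → ℚP.*-zeroʳ (sign ∣ ∁ (false ∷ W) ∣)) (allSubsets n)))) ⟩
    X + (∑[ W ∈ allSubsets n ] sign ∣ ∁ (false ∷ W) ∣ * 0ℚ) ∎
  by-first-vertex false = begin
    0ℚ * X  ≡⟨ ℚP.*-zeroˡ X ⟩
    0ℚ      ≡⟨ sym (ℚP.+-inverseʳ X) ⟩
    X - X   ≡⟨ cong (X +_) (sym (neg-distrib-∑ (allSubsets n) (λ W → sign ∣ ∁ W ∣ * ⟦ R W ⟧))) ⟩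
    X + (∑[ W ∈ allSubsets n ] - (sign ∣ ∁ W ∣ * ⟦ R W ⟧))
            ≡⟨ cong (X +_) (∑-cong (allSubsets n) (λ W → ℚP.neg-distribˡ-* (sign ∣ ∁ W ∣) ⟦ R W ⟧)) ⟩
    X + (∑[ W ∈ allSubsets n ] - sign ∣ ∁ W ∣ * ⟦ R W ⟧) ∎

inclusion-exclusion : ∀ n (t : Fin n → Bool) →
  ⟦ allB t (allFin n) ⟧ ≡ ∑[ W ∈ allSubsets n ] sign ∣ ∁ W ∣ * ⟦ allB (λ v → not (t v) ∨ lookup W v) (allFin n) ⟧
inclusion-exclusion zero    t = refl
inclusion-exclusion (suc n) t = begin
  ⟦ allB t (allFin (suc n)) ⟧
    ≡⟨ trans (cong ⟦_⟧ (allB-allFin-suc t)) (⟦∧⟧ (t Fin.zero) _) ⟩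
  ⟦ t Fin.zero ⟧ * ⟦ allB (t ∘ Fin.suc) (allFin n) ⟧
    ≡⟨ cong (⟦ t Fin.zero ⟧ *_) (inclusion-exclusion n (t ∘ Fin.suc)) ⟩
  ⟦ t Fin.zero ⟧ * (∑[ W ∈ allSubsets n ] sign ∣ ∁ W ∣ * ⟦ R W ⟧)
    ≡⟨ inclusion-exclusion-step R (t Fin.zero) ⟩
  ∑[ W ∈ allSubsets (suc n) ] sign ∣ ∁ W ∣ * ⟦ (not (t Fin.zero) ∨ Vec.head W) ∧ R (Vec.tail W) ⟧
    ≡⟨ ∑-cong (allSubsets (suc n)) (λ W → cong (λ x → sign ∣ ∁ W ∣ * ⟦ x ⟧) (sym (split-first W))) ⟩
  ∑[ W ∈ allSubsets (suc n) ] sign ∣ ∁ W ∣ * ⟦ allB (λ v → not (t v) ∨ lookup W v) (allFin (suc n)) ⟧ ∎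
  where
  R : Subset n → Bool
  R W = allB (λ v → not (t (Fin.suc v)) ∨ lookup W v) (allFin n)
  split-first : ∀ W → allB (λ v → not (t v) ∨ lookup W v) (allFin (suc n)) ≡ (not (t Fin.zero) ∨ Vec.head W) ∧ R (Vec.tail W)
  split-first (b ∷ W) = allB-allFin-suc (λ v → not (t v) ∨ lookup (b ∷ W) v)

addColourClass : {n : ℕ} → Subset n → Vec (Subset N) n → Vec (Subset (suc N)) n
addColourClass []      []      = []
addColourClass (b ∷ s) (c ∷ α) = (b ∷ c) ∷ addColourClass s α

lookup-addColourClass : {n : ℕ} (s : Subset n) (α : Vec (Subset N) n) (v : Fin n) →
                        lookup (addColourClass s α) v ≡ lookup s v ∷ lookup α v
lookup-addColourClass (b ∷ s) (c ∷ α) Fin.zero    = refl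
lookup-addColourClass (b ∷ s) (c ∷ α) (Fin.suc v) = lookup-addColourClass s α v

∑-colourings-suc : ∀ n (f : Vec (Subset (suc N)) n → ℚ) →
  ∑ (allVecs (allSubsets (suc N)) n) f ≡ ∑[ s ∈ allSubsets n ] ∑[ α ∈ allVecs (allSubsets N) n ] f (addColourClass s α)
∑-colourings-suc zero    f = sym (ℚP.+-identityʳ _)
∑-colourings-suc {N} (suc n) f = begin
  ∑ (allVecs (allSubsets (suc N)) (suc n)) f
    ≡⟨ ∑-allVecs-suc (allSubsets (suc N)) n f ⟩
  ∑[ c ∈ allSubsets (suc N) ] ∑[ α ∈ allVecs (allSubsets (suc N)) n ] f (c ∷ α)
    ≡⟨ ∑-cong (allSubsets (suc N)) (λ c → ∑-colourings-suc n (λ α → f (c ∷ α))) ⟩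
  ∑[ c ∈ allSubsets (suc N) ] ∑[ s ∈ allSubsets n ] ∑[ α ∈ allVecs (allSubsets N) n ] f (c ∷ addColourClass s α)
    ≡⟨ ∑-allSubsets-suc (λ c → ∑[ s ∈ allSubsets n ] ∑[ α ∈ Cs n ] f (c ∷ addColourClass s α)) ⟩
  first-colour-of true + first-colour-of false
    ≡⟨ cong₂ _+_ (first-vertex true) (first-vertex false) ⟩
  (∑[ s ∈ allSubsets n ] ∑[ α ∈ Cs (suc n) ] f (addColourClass (true ∷ s) α))
    + (∑[ s ∈ allSubsets n ] ∑[ α ∈ Cs (suc n) ] f (addColourClass (false ∷ s) α))
    ≡⟨ sym (∑-allSubsets-suc (λ s → ∑[ α ∈ Cs (suc n) ] f (addColourClass s α))) ⟩
  ∑[ s ∈ allSubsets (suc n) ] ∑[ α ∈ Cs (suc n) ] f (addColourClass s α) ∎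
  where
  Cs : (k : ℕ) → List (Vec (Subset N) k)
  Cs = allVecs (allSubsets N)
  first-colour-of : Bool → ℚ
  first-colour-of b = ∑[ c ∈ allSubsets N ] ∑[ s ∈ allSubsets n ] ∑[ α ∈ Cs n ] f ((b ∷ c) ∷ addColourClass s α)
  first-vertex : ∀ b → first-colour-of b ≡ ∑[ s ∈ allSubsets n ] ∑[ α ∈ Cs (suc n) ] f (addColourClass (b ∷ s) α)
  first-vertex b = trans (∑-comm (allSubsets N) (allSubsets n) _)
                         (∑-cong (allSubsets n) (λ s → sym (∑-allVecs-suc (allSubsets N) n (λ α → f (addColourClass (b ∷ s) α)))))

module _ {n : ℕ} (G : Graph n) (ω : PosWeight n) where

  sharesColour : Vec (Subset N) n → Fin n → Fin n → Bool
  sharesColour {N} α u v = anyB (λ i → lookup (lookup α u) i ∧ lookup (lookup α v) i) (allFin N)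

  edgeDisjoint : Vec (Subset N) n → Bool
  edgeDisjoint α = allB (λ u → allB (λ v → not (adj G u v ∧ sharesColour α u v)) (allFin n)) (allFin n)

  supportedIn : Vec (Subset N) n → Subset n → Bool
  supportedIn α W = allB (λ v → not (nonEmptyB (lookup α v)) ∨ lookup W v) (allFin n)

  isWeakColouring : Subset n → Mon N → Vec (Subset N) n → Bool
  isWeakColouring W m α = (edgeDisjoint α ∧ monEqB (monOf ω α) m) ∧ supportedIn α W

  weakColourings : Subset n → (N : ℕ) → Series N
  weakColourings W N m = ∑[ α ∈ allVecs (allSubsets N) n ] ⟦ isWeakColouring W m α ⟧

  indepOfWeight : Subset n → ℕ → Subset n → Bool
  indepOfWeight W k s = (s ⊆B W) ∧ isIndep G s ∧ (wtOf ω s ℕ.≡ᵇ k)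

  kromatic-inclusion-exclusion : (N : ℕ) (m : Mon N) →
    Kromatic N G ω m ≡ ∑[ W ∈ allSubsets n ] sign ∣ ∁ W ∣ * weakColourings W N m
  kromatic-inclusion-exclusion N m = begin
    Kromatic N G ω m
      ≡⟨ count≡∑⟦⟧ _ αs ⟩
    ∑[ α ∈ αs ] ⟦ (allNonEmpty α ∧ edgeDisjoint α) ∧ monEqB (monOf ω α) m ⟧
      ≡⟨ ∑-cong αs (λ α → trans (cong ⟦_⟧ (BoolP.∧-assoc (allNonEmpty α) _ _)) (⟦∧⟧ (allNonEmpty α) (P α))) ⟩
    ∑[ α ∈ αs ] ⟦ allNonEmpty α ⟧ * ⟦ P α ⟧
      ≡⟨ ∑-cong αs (λ α → cong (_* ⟦ P α ⟧) (inclusion-exclusion n (λ v → nonEmptyB (lookup α v)))) ⟩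
    ∑[ α ∈ αs ] (∑[ W ∈ Ws ] sign ∣ ∁ W ∣ * ⟦ supportedIn α W ⟧) * ⟦ P α ⟧
      ≡⟨ ∑-cong αs (λ α → trans (*-distribʳ-∑ ⟦ P α ⟧ Ws _) (∑-cong Ws (λ W → merge (sign ∣ ∁ W ∣) (supportedIn α W) (P α)))) ⟩
    ∑[ α ∈ αs ] ∑[ W ∈ Ws ] sign ∣ ∁ W ∣ * ⟦ P α ∧ supportedIn α W ⟧
      ≡⟨ ∑-comm αs Ws _ ⟩
    ∑[ W ∈ Ws ] ∑[ α ∈ αs ] sign ∣ ∁ W ∣ * ⟦ P α ∧ supportedIn α W ⟧
      ≡⟨ ∑-cong Ws (λ W → sym (*-distribˡ-∑ (sign ∣ ∁ W ∣) αs _)) ⟩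
    ∑[ W ∈ Ws ] sign ∣ ∁ W ∣ * weakColourings W N m ∎
    where
    αs = allVecs (allSubsets N) n
    Ws = allSubsets n
    allNonEmpty : Vec (Subset N) n → Bool
    allNonEmpty α = allB (λ v → nonEmptyB (lookup α v)) (allFin n)
    P : Vec (Subset N) n → Bool
    P α = edgeDisjoint α ∧ monEqB (monOf ω α) m
    merge : ∀ s r p → (s * ⟦ r ⟧) * ⟦ p ⟧ ≡ s * ⟦ p ∧ r ⟧
    merge s r p = trans (ℚP.*-assoc s ⟦ r ⟧ ⟦ p ⟧) (cong (s *_) (trans (ℚP.*-comm ⟦ r ⟧ ⟦ p ⟧) (sym (⟦∧⟧ p r))))

  monOf-addColourClass : (s : Subset n) (α : Vec (Subset N) n) → monOf ω (addColourClass s α) ≡ wtOf ω s ∷ monOf ω α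
  monOf-addColourClass s α = cong₂ _∷_ (entry Fin.zero) (VecP.tabulate-cong (entry ∘ Fin.suc))
    where
    entry : ∀ i → NL.sum (List.map (λ v → if lookup (lookup (addColourClass s α) v) i then wt ω v else 0) (allFin n))
                ≡ NL.sum (List.map (λ v → if lookup (lookup s v ∷ lookup α v) i then wt ω v else 0) (allFin n))
    entry i = cong NL.sum (ListP.map-cong (λ v → cong (λ c → if lookup c i then wt ω v else 0) (lookup-addColourClass s α v))
                                          (allFin n))

  sharesColour-addColourClass : (s : Subset n) (α : Vec (Subset N) n) (u v : Fin n) →
    sharesColour (addColourClass s α) u v ≡ (lookup s u ∧ lookup s v) ∨ sharesColour α u v
  sharesColour-addColourClass s α u v = begin
    sharesColour (addColourClass s α) u v
      ≡⟨ cong₂ (λ c d → anyB (λ i → lookup c i ∧ lookup d i) (allFin _)) (lookup-addColourClass s α u) (lookup-addColourClass s α v) ⟩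
    anyB (λ i → lookup (lookup s u ∷ lookup α u) i ∧ lookup (lookup s v ∷ lookup α v) i) (allFin _)
      ≡⟨ anyB-allFin-suc (λ i → lookup (lookup s u ∷ lookup α u) i ∧ lookup (lookup s v ∷ lookup α v) i) ⟩
    (lookup s u ∧ lookup s v) ∨ sharesColour α u v ∎

  edgeDisjoint-addColourClass : (s : Subset n) (α : Vec (Subset N) n) →
                                edgeDisjoint (addColourClass s α) ≡ isIndep G s ∧ edgeDisjoint α
  edgeDisjoint-addColourClass s α =
    trans (allB-cong (allFin n) (λ u → trans (allB-cong (allFin n) (pair u)) (allB-∧ _ _ (allFin n)))) (allB-∧ _ _ (allFin n))
    where
    split-not : ∀ e su sv x → not (e ∧ ((su ∧ sv) ∨ x)) ≡ not (su ∧ sv ∧ e) ∧ not (e ∧ x)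
    split-not false true  true  x = refl
    split-not false true  false x = refl
    split-not false false sv    x = refl
    split-not true  true  true  x = refl
    split-not true  true  false x = refl
    split-not true  false sv    x = refl
    pair : ∀ u v → not (adj G u v ∧ sharesColour (addColourClass s α) u v)
                 ≡ not (lookup s u ∧ lookup s v ∧ adj G u v) ∧ not (adj G u v ∧ sharesColour α u v)
    pair u v = trans (cong (λ b → not (adj G u v ∧ b)) (sharesColour-addColourClass s α u v))
                     (split-not (adj G u v) (lookup s u) (lookup s v) (sharesColour α u v))

  supportedIn-addColourClass : (s : Subset n) (α : Vec (Subset N) n) (W : Subset n) →
                               supportedIn (addColourClass s α) W ≡ (s ⊆B W) ∧ supportedIn α W
  supportedIn-addColourClass s α W = trans (allB-cong (allFin n) vertex) (allB-∧ _ _ (allFin n))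
    where
    split-implication : ∀ a b w → not (a ∨ b) ∨ w ≡ (not a ∨ w) ∧ (not b ∨ w)
    split-implication true  b     true  = sym (BoolP.∨-zeroʳ (not b))
    split-implication true  b     false = refl
    split-implication false true  w     = refl
    split-implication false false w     = refl
    vertex : ∀ v → not (nonEmptyB (lookup (addColourClass s α) v)) ∨ lookup W v
                 ≡ (not (lookup s v) ∨ lookup W v) ∧ (not (nonEmptyB (lookup α v)) ∨ lookup W v)
    vertex v = begin
      not (nonEmptyB (lookup (addColourClass s α) v)) ∨ lookup W v
        ≡⟨ cong (λ c → not (nonEmptyB c) ∨ lookup W v) (lookup-addColourClass s α v) ⟩
      not (nonEmptyB (lookup s v ∷ lookup α v)) ∨ lookup W v
        ≡⟨ cong (λ b → not b ∨ lookup W v) (nonEmptyB-∷ (lookup s v) (lookup α v)) ⟩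
      not (lookup s v ∨ nonEmptyB (lookup α v)) ∨ lookup W v
        ≡⟨ split-implication (lookup s v) (nonEmptyB (lookup α v)) (lookup W v) ⟩
      (not (lookup s v) ∨ lookup W v) ∧ (not (nonEmptyB (lookup α v)) ∨ lookup W v) ∎

  isWeakColouring-addColourClass : (W : Subset n) (k : ℕ) (m : Mon N) (s : Subset n) (α : Vec (Subset N) n) →
    isWeakColouring W (k ∷ m) (addColourClass s α) ≡ indepOfWeight W k s ∧ isWeakColouring W m α
  isWeakColouring-addColourClass W k m s α = begin
    (edgeDisjoint (addColourClass s α) ∧ monEqB (monOf ω (addColourClass s α)) (k ∷ m)) ∧ supportedIn (addColourClass s α) W
      ≡⟨ cong₂ (λ x y → (x ∧ monEqB y (k ∷ m)) ∧ supportedIn (addColourClass s α) W)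
               (edgeDisjoint-addColourClass s α) (monOf-addColourClass s α) ⟩
    ((isIndep G s ∧ edgeDisjoint α) ∧ ((wtOf ω s ℕ.≡ᵇ k) ∧ monEqB (monOf ω α) m)) ∧ supportedIn (addColourClass s α) W
      ≡⟨ cong (((isIndep G s ∧ edgeDisjoint α) ∧ ((wtOf ω s ℕ.≡ᵇ k) ∧ monEqB (monOf ω α) m)) ∧_)
              (supportedIn-addColourClass s α W) ⟩
    ((isIndep G s ∧ edgeDisjoint α) ∧ ((wtOf ω s ℕ.≡ᵇ k) ∧ monEqB (monOf ω α) m)) ∧ ((s ⊆B W) ∧ supportedIn α W)
      ≡⟨ shuffle (isIndep G s) (edgeDisjoint α) (wtOf ω s ℕ.≡ᵇ k) (monEqB (monOf ω α) m) (s ⊆B W) (supportedIn α W) ⟩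
    indepOfWeight W k s ∧ isWeakColouring W m α ∎
    where
    shuffle : ∀ i d w e c s → ((i ∧ d) ∧ (w ∧ e)) ∧ (c ∧ s) ≡ (c ∧ (i ∧ w)) ∧ ((d ∧ e) ∧ s)
    shuffle = 𝔹-solve 6 (λ i d w e c s → ((i :∧ d) :∧ (w :∧ e)) :∧ (c :∧ s) :≡ (c :∧ (i :∧ w)) :∧ ((d :∧ e) :∧ s)) refl
      where open ∨-∧-Solver using () renaming (solve to 𝔹-solve; _:*_ to _:∧_; _:=_ to _:≡_)

  weakColourings-∷ : (W : Subset n) (N k : ℕ) (m : Mon N) →
                     weakColourings W (suc N) (k ∷ m) ≡ indepPoly G ω W (k ∷ []) * weakColourings W N m
  weakColourings-∷ W N k m = begin
    weakColourings W (suc N) (k ∷ m)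
      ≡⟨ ∑-colourings-suc n (λ β → ⟦ isWeakColouring W (k ∷ m) β ⟧) ⟩
    ∑[ s ∈ Ss ] ∑[ α ∈ αs ] ⟦ isWeakColouring W (k ∷ m) (addColourClass s α) ⟧
      ≡⟨ ∑-cong Ss (λ s → ∑-cong αs (λ α → trans (cong ⟦_⟧ (isWeakColouring-addColourClass W k m s α))
                                                  (⟦∧⟧ (indepOfWeight W k s) (isWeakColouring W m α)))) ⟩
    ∑[ s ∈ Ss ] ∑[ α ∈ αs ] ⟦ indepOfWeight W k s ⟧ * ⟦ isWeakColouring W m α ⟧
      ≡⟨ ∑-cong Ss (λ s → sym (*-distribˡ-∑ ⟦ indepOfWeight W k s ⟧ αs (λ α → ⟦ isWeakColouring W m α ⟧))) ⟩
    ∑[ s ∈ Ss ] ⟦ indepOfWeight W k s ⟧ * weakColourings W N m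
      ≡⟨ sym (*-distribʳ-∑ (weakColourings W N m) Ss (λ s → ⟦ indepOfWeight W k s ⟧)) ⟩
    (∑[ s ∈ Ss ] ⟦ indepOfWeight W k s ⟧) * weakColourings W N m
      ≡⟨ cong (_* weakColourings W N m) (sym (count≡∑⟦⟧ (indepOfWeight W k) Ss)) ⟩
    indepPoly G ω W (k ∷ []) * weakColourings W N m ∎
    where
    Ss = allSubsets n
    αs = allVecs (allSubsets N) n

  weakColourings-[] : (W : Subset n) → weakColourings W 0 [] ≡ 1ℚ
  weakColourings-[] W =
    trans (∑-allVecs-singleton [] n _) (cong ⟦_⟧ (cong₂ (λ x y → (x ∧ true) ∧ y) edgeDisjoint-[] supportedIn-[]))
    where
    α₀ = Vec.replicate n []
    no-shared-colour : ∀ u → allB (λ v → not (adj G u v ∧ false)) (allFin n) ≡ true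
    no-shared-colour u = trans (allB-cong (allFin n) (λ v → cong not (BoolP.∧-zeroʳ (adj G u v)))) (allB-true (allFin n))
    edgeDisjoint-[] : edgeDisjoint α₀ ≡ true
    edgeDisjoint-[] = trans (allB-cong (allFin n) no-shared-colour) (allB-true (allFin n))
    supportedIn-[] : supportedIn α₀ W ≡ true
    supportedIn-[] = allB-true (allFin n)

  weakColourings≗tensorPower : (W : Subset n) (N : ℕ) → weakColourings W N ≗ tensorPower (indepPoly G ω W) N
  weakColourings≗tensorPower W zero    []      = weakColourings-[] W
  weakColourings≗tensorPower W (suc N) (k ∷ m) =
    trans (weakColourings-∷ W N k m) (cong (indepPoly G ω W (k ∷ []) *_) (weakColourings≗tensorPower W N m))

theorem1p1 : ∀ {n : ℕ} (G : Graph n) (ω : PosWeight n)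
               (a : Subset n → ℕ → ℚ) →
               (∀ W → IsExponents G ω W (a W)) →
               ∀ (N : ℕ) (m : Mon N) →
               Kromatic N G ω m
                 ≡ Σℚ (map (λ W → sign ∣ ∁ W ∣ Data.Rational.* infProd (pbarFactor N (a W)) m)
                           (allSubsets n))
theorem1p1 {n} G ω a exponents N m = begin
  Kromatic N G ω m
    ≡⟨ kromatic-inclusion-exclusion G ω N m ⟩
  ∑[ W ∈ allSubsets n ] sign ∣ ∁ W ∣ * weakColourings G ω W N m
    ≡⟨ ∑-cong (allSubsets n) (λ W → cong (sign ∣ ∁ W ∣ *_) (weakColourings≡infProd W)) ⟩
  ∑[ W ∈ allSubsets n ] sign ∣ ∁ W ∣ * infProd (pbarFactor N (a W)) m ∎
  where
  weakColourings≡infProd : ∀ W → weakColourings G ω W N m ≡ infProd (pbarFactor N (a W)) m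
  weakColourings≡infProd W = begin
    weakColourings G ω W N m                   ≡⟨ weakColourings≗tensorPower G ω W N m ⟩
    tensorPower (indepPoly G ω W) N m          ≡⟨ tensorPower-cong (λ d → sym (exponents W d)) N m ⟩
    tensorPower (infProd (tFactor (a W))) N m  ≡⟨ sym (infProd-pbarFactor (a W) N m) ⟩
    infProd (pbarFactor N (a W)) m             ∎
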